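{- Let $A\in\operatorname{M}_2(\mathbb{Z})$ be non-singular with $\mathcal{P}(A)\ne\emptyset$ and $\mathcal{P}'(A)\ne\emptyset$, and assume $h_A$ is reducible. Then $A$ has distinct eigenvalues $\lambda_1,\lambda_2\in\mathbb{Z}$, and: (1) If $\operatorname{rad}(\lambda_1)$ does not divide $\operatorname{rad}(\lambda_2)$ and $\operatorname{rad}(\lambda_2)$ does not divide $\operatorname{rad}(\lambda_1)$, then: if there exists a matrix $M\in\operatorname{M}_2(\mathbb{Z})$ diagonalizing $A^t$ with $\det M$ dividing $2$, then $\vec N(X_A)\cong\mathbb{Z}/2\mathbb{Z}\times\mathbb{Z}/2\mathbb{Z}$; otherwise $\vec N(X_A)=\{\pm\operatorname{id}\}$. (2) If $\operatorname{rad}(\lambda_1)\mid\operatorname{rad}(\lambda_2)$ or $\operatorname{rad}(\lambda_2)\mid\operatorname{rad}(\lambda_1)$, then $\vec N(X_A)$ is isomorphic to the group of lower-triangular matrices in $\operatorname{GL}_2(\mathbb{Z})$.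
   Context: $h_A$ is the characteristic polynomial of $A$; $\mathcal{P}(A)$ is the set of primes dividing $\det A$; $\mathcal{P}'(A)=\{p\in\mathcal{P}(A)\mid h_A\not\equiv x^2\pmod p\}$. $\operatorname{rad}(m)$ is the product of the distinct primes dividing $m$. $X_A$ is the $\mathbb{Z}^2$-odometer $\varprojlim\mathbb{Z}^2/A^i\mathbb{Z}^2$, and its linear representation group $\vec N(X_A)$ is (and here is taken to be) the set of $T\in\operatorname{GL}_2(\mathbb{Z})$ such that for every $m\in\mathbb{N}\cup\{0\}$ there is $k_m\in\mathbb{N}\cup\{0\}$ with $A^{ -m}TA^{k_m}\in\operatorname{M}_2(\mathbb{Z})$. -}

module Defs where

open import Data.Nat as ℕ using (ℕ; zero; suc)
import Data.Nat.Divisibility as ℕD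
open import Data.Nat.Primality using (Prime; prime?)
open import Data.Integer using (ℤ; +_; -_; _+_; _-_; _*_; ∣_∣; 0ℤ; 1ℤ; -1ℤ)
open import Data.Integer.Divisibility using (_∣_)
open import Data.Bool using (Bool; _xor_)
open import Data.List using (List; filter; upTo)
open import Data.Nat.ListAction using (product)
open import Data.Unit using (⊤)
open import Data.Product using (Σ; ∃; _×_; _,_)
open import Data.Sum using (_⊎_)
open import Relation.Nullary using (¬_)
open import Relation.Nullary.Decidable using (_×-dec_)
open import Relation.Binary.PropositionalEquality using (_≡_; _≢_)

-- 2×2 integer matrices  (mat a b c d  =  [[a , b] , [c , d]])

record Mat : Set where
  constructor mat
  field
    a₁₁ a₁₂ a₂₁ a₂₂ : ℤ
open Mat public

infixl 7 _·_
_·_ : Mat → Mat → Mat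
mat a b c d · mat e f g h =
  mat (a * e + b * g) (a * f + b * h) (c * e + d * g) (c * f + d * h)

idM : Mat
idM = mat 1ℤ 0ℤ 0ℤ 1ℤ

negM : Mat → Mat
negM (mat a b c d) = mat (- a) (- b) (- c) (- d)

transpose : Mat → Mat
transpose (mat a b c d) = mat a c b d

det : Mat → ℤ
det (mat a b c d) = a * d - b * c

trace : Mat → ℤ
trace (mat a b c d) = a + d

pow : Mat → ℕ → Mat
pow A zero    = idM
pow A (suc n) = A · pow A n

IsDiagonal : Mat → Set
IsDiagonal D = (a₁₂ D ≡ 0ℤ) × (a₂₁ D ≡ 0ℤ)

InGL : Mat → Set
InGL T = (det T ≡ 1ℤ) ⊎ (det T ≡ -1ℤ)

LowerTriGL : Mat → Set
LowerTriGL T = InGL T × (a₁₂ T ≡ 0ℤ)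

-- Polynomials of degree ≤ 2 over ℤ, as coefficient triples c₀ + c₁ x + c₂ x²

record Poly2 : Set where
  constructor poly
  field
    c₀ c₁ c₂ : ℤ
open Poly2 public

-- characteristic polynomial h_A = det(x·id − A) = x² − tr(A) x + det A
charPoly : Mat → Poly2
charPoly A = poly (det A) (- trace A) 1ℤ

evalP : Poly2 → ℤ → ℤ
evalP (poly a b c) x = a + b * x + c * (x * x)

xSq : Poly2
xSq = poly 0ℤ 0ℤ 1ℤ

CongMod : ℕ → Poly2 → Poly2 → Set
CongMod p f g = ((+ p) ∣ (c₀ f - c₀ g)) × ((+ p) ∣ (c₁ f - c₁ g)) × ((+ p) ∣ (c₂ f - c₂ g))

mulLin : ℤ → ℤ → ℤ → ℤ → Poly2
mulLin a₀ a₁ b₀ b₁ = poly (a₀ * b₀) (a₀ * b₁ + a₁ * b₀) (a₁ * b₁)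

-- a degree-2 polynomial is reducible (over ℤ) iff it is the product of two
-- non-constant polynomials, which then necessarily have degree 1
Reducible : Poly2 → Set
Reducible f = Σ ℤ λ a₀ → Σ ℤ λ a₁ → Σ ℤ λ b₀ → Σ ℤ λ b₁ →
  (a₁ ≢ 0ℤ) × (b₁ ≢ 0ℤ) × (mulLin a₀ a₁ b₀ b₁ ≡ f)

IsEigenvalue : Mat → ℤ → Set
IsEigenvalue A λ′ = evalP (charPoly A) λ′ ≡ 0ℤ

InP : Mat → ℕ → Set
InP A p = Prime p × ((+ p) ∣ det A)

InP′ : Mat → ℕ → Set
InP′ A p = InP A p × ¬ CongMod p (charPoly A) xSq

-- radical: product of the distinct primes dividing m (for m ≥ 1)

radℕ : ℕ → ℕ
radℕ n = product (filter (λ p → prime? p ×-dec p ℕD.∣? n) (upTo (suc n)))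

rad : ℤ → ℕ
rad m = radℕ ∣ m ∣

-- The linear representation group  N⃗(X_A):
-- T ∈ GL₂(ℤ) with ∀ m ∃ k, A^{-m} T A^k ∈ M₂(ℤ),
-- i.e. ∃ B ∈ M₂(ℤ) with A^m B = T A^k   (A non-singular)

InN : Mat → Mat → Set
InN A T = InGL T × ((m : ℕ) → Σ ℕ λ k → Σ Mat λ B → pow A m · B ≡ T · pow A k)

record GroupIso {A B : Set} (P : A → Set) (_∙_ : A → A → A)
                (Q : B → Set) (_∘_ : B → B → B) : Set where
  field
    to     : (a : A) → P a → B
    to-Q   : (a : A) (p : P a) → Q (to a p)
    from   : (b : B) → Q b → A
    from-P : (b : B) (q : Q b) → P (from b q)
    from-to : (a : A) (p : P a) → from (to a p) (to-Q a p) ≡ a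
    to-from : (b : B) (q : Q b) → to (from b q) (from-P b q) ≡ b
    hom    : (a a′ : A) (p : P a) (p′ : P a′) (pp : P (a ∙ a′)) →
             to (a ∙ a′) pp ≡ (to a p ∘ to a′ p′)

-- ℤ/2ℤ × ℤ/2ℤ, with ℤ/2ℤ realised as (Bool , xor)
V4 : Set
V4 = Bool × Bool

_⊕_ : V4 → V4 → V4
(x , y) ⊕ (x′ , y′) = (x xor x′) , (y xor y′)

AllV4 : V4 → Set
AllV4 _ = ⊤

-- Since h_A splits, A has integer eigenvalues μ₁ ≠ μ₂, and putting a
-- primitive μ₂-eigenvector into the second column of some Q ∈ SL₂(ℤ) makes
-- Q⁻¹ A Q = L = [[μ₁, 0], [c, μ₂]]. If T ∈ N⃗(L), i.e. Lᵐ B = T Lᵏ with B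
-- integral, then for a left α-eigenvector u and a right γ-eigenvector v of L
-- we get αᵐ (u B v) = γᵏ (u T v); so when a prime divides α but not γ,
-- all its powers divide u T v, which therefore vanishes. A prime dividing μ₁
-- but not μ₂ makes T lower triangular (u = e₁, v = e₂); if a prime also
-- divides μ₂ but not μ₁, T commutes with L as well. The centralizer of L in
-- GL₂(ℤ) is {±1}, or a Klein four-group when a reflection [[1,0],[s,-1]]
-- commutes with L, which is exactly when Lᵀ is diagonalized by a matrix of
-- determinant ±2 (or ±1). If instead every prime of μ₂ divides μ₁, then
-- μ₂ᵐ ∣ μ₁ʲ for some j, and L⁻ᵐ T Lᵐ⁺ʲ is integral for every
-- lower-triangular T ∈ GL₂(ℤ).

module Submission where

open import Defs
open import Data.Nat as ℕ using (ℕ; zero; suc; _<_)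
import Data.Nat.Properties as ℕ
open import Data.Nat.Divisibility as ℕ using () renaming (_∣_ to _∣ℕ_)
open import Data.Nat.Primality using (Prime; prime?; euclidsLemma; prime⇒nonZero; prime⇒nonTrivial)
open import Data.Integer as ℤ using (ℤ; +_; -[1+_]; -_; _+_; _-_; _*_; _^_; ∣_∣; 0ℤ; 1ℤ; -1ℤ)
import Data.Integer.Properties as ℤ
open import Data.Integer.Divisibility using (_∣_)
import Data.Integer.Divisibility.Signed as Signed
open import Data.Integer.Tactic.RingSolver using (solve-∀; solve)
open import Data.List using (List; _∷_; []; _++_; [_]; filter; upTo; length)
import Data.List.Properties as List
open import Data.List.Membership.Propositional using (_∈_)
open import Data.List.Membership.Propositional.Properties using (∈-filter⁺; ∈-filter⁻; ∈-upTo⁺)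
open import Data.List.Relation.Unary.Any as Any using (Any; here; there; any?)
open import Data.List.Relation.Unary.All as All using (All)
open import Data.List.Relation.Unary.All.Properties using (all-filter)
open import Data.Nat.ListAction using (product)
open import Data.Nat.ListAction.Properties using (∈⇒∣product)
open import Data.Nat.Primality.Factorisation using (PrimeFactorisation; factorise; factorisationHasAllPrimeFactors)
open import Data.Product using (Σ; _×_; _,_; proj₁; proj₂)
open import Data.Product.Properties using (≡-dec)
open import Data.Nat.GCD using (module Bézout; gcd-GCD)
open import Data.Integer.GCD using (gcd; gcd[i,j]∣i; gcd[i,j]∣j; gcd[i,j]≡0⇒i≡0; gcd[i,j]≡0⇒j≡0)
open import Data.Sum using (_⊎_; inj₁; inj₂; [_,_]′)
open import Data.Empty using (⊥-elim)
open import Data.Bool using (Bool; true; false; _xor_)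
open import Data.Unit using (tt)
open import Relation.Nullary using (¬_; Dec; yes; no)
open import Relation.Nullary.Decidable using (_×-dec_; ¬?)
open import Relation.Binary.PropositionalEquality hiding ([_])
open import Function.Bundles using (_⇔_; mk⇔; Equivalence)
import Function.Properties.Equivalence as ⇔
open import Data.Sum.Function.Propositional using (_⊎-⇔_)
open import Function.Base using (_∘_; id)
open ≡-Reasoning

-- Matrix algebra

mat-≡ : ∀ {a b c d a′ b′ c′ d′} → a ≡ a′ → b ≡ b′ → c ≡ c′ → d ≡ d′ →
        mat a b c d ≡ mat a′ b′ c′ d′
mat-≡ refl refl refl refl = refl

scalar : ℤ → Mat
scalar α = mat α 0ℤ 0ℤ α

adj : Mat → Mat
adj (mat a b c d) = mat d (- b) (- c) a

·-assoc : ∀ X Y Z → (X · Y) · Z ≡ X · (Y · Z)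
·-assoc (mat a b c d) (mat e f g h) (mat i j k l) =
  mat-≡ (entry a b e f g h i k) (entry a b e f g h j l)
        (entry c d e f g h i k) (entry c d e f g h j l)
  where
  entry : ∀ a b e f g h i k →
          (a * e + b * g) * i + (a * f + b * h) * k ≡ a * (e * i + f * k) + b * (g * i + h * k)
  entry = solve-∀

·-scalarˡ : ∀ α X → scalar α · X ≡ mat (α * a₁₁ X) (α * a₁₂ X) (α * a₂₁ X) (α * a₂₂ X)
·-scalarˡ α (mat a b c d) = mat-≡ (entry α a c) (entry α b d) (entry′ α a c) (entry′ α b d)
  where
  entry : ∀ α x y → α * x + 0ℤ * y ≡ α * x
  entry = solve-∀
  entry′ : ∀ α x y → 0ℤ * x + α * y ≡ α * y
  entry′ = solve-∀

·-scalarʳ : ∀ α X → X · scalar α ≡ mat (α * a₁₁ X) (α * a₁₂ X) (α * a₂₁ X) (α * a₂₂ X)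
·-scalarʳ α (mat a b c d) = mat-≡ (entry α a b) (entry′ α a b) (entry α c d) (entry′ α c d)
  where
  entry : ∀ α x y → x * α + y * 0ℤ ≡ α * x
  entry = solve-∀
  entry′ : ∀ α x y → x * 0ℤ + y * α ≡ α * y
  entry′ = solve-∀

scalar-comm : ∀ α X → X · scalar α ≡ scalar α · X
scalar-comm α X = trans (·-scalarʳ α X) (sym (·-scalarˡ α X))

·-identityˡ : ∀ X → idM · X ≡ X
·-identityˡ X@(mat a b c d) =
  trans (·-scalarˡ 1ℤ X) (mat-≡ (ℤ.*-identityˡ a) (ℤ.*-identityˡ b) (ℤ.*-identityˡ c) (ℤ.*-identityˡ d))

·-identityʳ : ∀ X → X · idM ≡ X
·-identityʳ X = trans (scalar-comm 1ℤ X) (·-identityˡ X)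

det-· : ∀ X Y → det (X · Y) ≡ det X * det Y
det-· (mat a b c d) (mat e f g h) = product-formula a b c d e f g h
  where
  product-formula : ∀ a b c d e f g h →
    (a * e + b * g) * (c * f + d * h) - (a * f + b * h) * (c * e + d * g) ≡ (a * d - b * c) * (e * h - f * g)
  product-formula = solve-∀

transpose-· : ∀ X Y → transpose (X · Y) ≡ transpose Y · transpose X
transpose-· (mat a b c d) (mat e f g h) =
  mat-≡ (swap a e b g) (swap c e d g) (swap a f b h) (swap c f d h)
  where
  swap : ∀ a b c d → a * b + c * d ≡ b * a + d * c
  swap = solve-∀

det-transpose : ∀ X → det (transpose X) ≡ det X
det-transpose (mat a b c d) = cong (λ x → a * d - x) (ℤ.*-comm c b)

·-adj : ∀ X → X · adj X ≡ scalar (det X)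
·-adj (mat a b c d) = mat-≡ (diagonal a b c d) (off a b) (off′ c d) (diagonal′ a b c d)
  where
  diagonal : ∀ a b c d → a * d + b * - c ≡ a * d - b * c
  diagonal = solve-∀
  diagonal′ : ∀ a b c d → c * - b + d * a ≡ a * d - b * c
  diagonal′ = solve-∀
  off : ∀ a b → a * - b + b * a ≡ 0ℤ
  off = solve-∀
  off′ : ∀ c d → c * d + d * - c ≡ 0ℤ
  off′ = solve-∀

adj-· : ∀ X → adj X · X ≡ scalar (det X)
adj-· (mat a b c d) = mat-≡ (diagonal a b c d) (off b d) (off′ a c) (diagonal′ a b c d)
  where
  diagonal : ∀ a b c d → d * a + - b * c ≡ a * d - b * c
  diagonal = solve-∀
  diagonal′ : ∀ a b c d → - c * b + a * d ≡ a * d - b * c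
  diagonal′ = solve-∀
  off : ∀ b d → d * b + - b * d ≡ 0ℤ
  off = solve-∀
  off′ : ∀ a c → - c * a + a * c ≡ 0ℤ
  off′ = solve-∀

adj-adj : ∀ X → adj (adj X) ≡ X
adj-adj (mat a b c d) = mat-≡ refl (ℤ.neg-involutive b) (ℤ.neg-involutive c) refl

det-adj : ∀ X → det (adj X) ≡ det X
det-adj (mat a b c d) = entry a b c d
  where
  entry : ∀ a b c d → d * a - - b * - c ≡ a * d - b * c
  entry = solve-∀

trace-comm : ∀ X Y → trace (X · Y) ≡ trace (Y · X)
trace-comm (mat a b c d) (mat e f g h) = entry a b c d e f g h
  where
  entry : ∀ a b c d e f g h → a * e + b * g + (c * f + d * h) ≡ e * a + f * c + (g * b + h * d)
  entry = solve-∀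

cancel-middle : ∀ {P R} → P · R ≡ idM → ∀ X Y → (X · P) · (R · Y) ≡ X · Y
cancel-middle {P} {R} PR≡id X Y = begin
  (X · P) · (R · Y) ≡⟨ ·-assoc X P (R · Y) ⟩
  X · (P · (R · Y)) ≡⟨ cong (X ·_) (sym (·-assoc P R Y)) ⟩
  X · ((P · R) · Y) ≡⟨ cong (λ Z → X · (Z · Y)) PR≡id ⟩
  X · (idM · Y)     ≡⟨ cong (X ·_) (·-identityˡ Y) ⟩
  X · Y             ∎

-- Conjugation by a matrix of determinant 1

-- A record rather than det Q ≡ 1ℤ, so that Q can be inferred from a proof.
record InSL (Q : Mat) : Set where
  constructor mkSL
  field det≡1 : det Q ≡ 1ℤ

adj-InSL : ∀ {Q} → InSL Q → InSL (adj Q)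
adj-InSL {Q} (mkSL det-Q) = mkSL (trans (det-adj Q) det-Q)

conj : Mat → Mat → Mat
conj Q X = adj Q · X · Q

module _ {Q : Mat} (Q∈SL : InSL Q) where

  private
    det-Q : det Q ≡ 1ℤ
    det-Q = InSL.det≡1 Q∈SL

  adj-inverseˡ : adj Q · Q ≡ idM
  adj-inverseˡ = trans (adj-· Q) (cong scalar det-Q)

  adj-inverseʳ : Q · adj Q ≡ idM
  adj-inverseʳ = trans (·-adj Q) (cong scalar det-Q)

  conj-· : ∀ X Y → conj Q (X · Y) ≡ conj Q X · conj Q Y
  conj-· X Y = sym (begin
    (adj Q · X · Q) · (adj Q · Y · Q) ≡⟨ sym (·-assoc (adj Q · X · Q) (adj Q · Y) Q) ⟩
    (adj Q · X · Q) · (adj Q · Y) · Q ≡⟨ cong (_· Q) (cancel-middle adj-inverseʳ (adj Q · X) Y) ⟩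
    adj Q · X · Y · Q                 ≡⟨ cong (_· Q) (·-assoc (adj Q) X Y) ⟩
    adj Q · (X · Y) · Q               ∎)

  conj-scalar : ∀ α → conj Q (scalar α) ≡ scalar α
  conj-scalar α = begin
    adj Q · scalar α · Q   ≡⟨ cong (_· Q) (scalar-comm α (adj Q)) ⟩
    scalar α · adj Q · Q   ≡⟨ ·-assoc (scalar α) (adj Q) Q ⟩
    scalar α · (adj Q · Q) ≡⟨ cong (scalar α ·_) adj-inverseˡ ⟩
    scalar α · idM         ≡⟨ ·-identityʳ (scalar α) ⟩
    scalar α               ∎

  conj-adj : ∀ X → conj (adj Q) (conj Q X) ≡ X
  conj-adj X = begin
    adj (adj Q) · (adj Q · X · Q) · adj Q ≡⟨ cong (λ Z → Z · (adj Q · X · Q) · adj Q) (adj-adj Q) ⟩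
    Q · (adj Q · X · Q) · adj Q           ≡⟨ cong (_· adj Q) (sym (·-assoc Q (adj Q · X) Q)) ⟩
    Q · (adj Q · X) · Q · adj Q           ≡⟨ ·-assoc (Q · (adj Q · X)) Q (adj Q) ⟩
    Q · (adj Q · X) · (Q · adj Q)         ≡⟨ cong (Q · (adj Q · X) ·_) adj-inverseʳ ⟩
    Q · (adj Q · X) · idM                 ≡⟨ ·-identityʳ (Q · (adj Q · X)) ⟩
    Q · (adj Q · X)                       ≡⟨ sym (·-assoc Q (adj Q) X) ⟩
    Q · adj Q · X                         ≡⟨ cong (_· X) adj-inverseʳ ⟩
    idM · X                               ≡⟨ ·-identityˡ X ⟩
    X                                     ∎

  pow-conj : ∀ A n → pow (conj Q A) n ≡ conj Q (pow A n)
  pow-conj A zero    = sym (conj-scalar 1ℤ)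
  pow-conj A (suc n) = trans (cong (conj Q A ·_) (pow-conj A n)) (sym (conj-· A (pow A n)))

  det-conj : ∀ X → det (conj Q X) ≡ det X
  det-conj X = begin
    det (adj Q · X · Q)             ≡⟨ det-· (adj Q · X) Q ⟩
    det (adj Q · X) * det Q         ≡⟨ cong₂ _*_ (det-· (adj Q) X) det-Q ⟩
    det (adj Q) * det X * 1ℤ        ≡⟨ ℤ.*-identityʳ (det (adj Q) * det X) ⟩
    det (adj Q) * det X             ≡⟨ cong (_* det X) (trans (det-adj Q) det-Q) ⟩
    1ℤ * det X                      ≡⟨ ℤ.*-identityˡ (det X) ⟩
    det X                           ∎

  trace-conj : ∀ X → trace (conj Q X) ≡ trace X
  trace-conj X = begin
    trace (adj Q · X · Q)   ≡⟨ trace-comm (adj Q · X) Q ⟩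
    trace (Q · (adj Q · X)) ≡⟨ cong trace (sym (·-assoc Q (adj Q) X)) ⟩
    trace (Q · adj Q · X)   ≡⟨ cong (λ Z → trace (Z · X)) adj-inverseʳ ⟩
    trace (idM · X)         ≡⟨ cong trace (·-identityˡ X) ⟩
    trace X                 ∎

conj-adj′ : ∀ {Q} → InSL Q → ∀ X → conj Q (conj (adj Q) X) ≡ X
conj-adj′ {Q} Q∈SL X = subst (λ Z → conj Z (conj (adj Q) X) ≡ X) (adj-adj Q) (conj-adj (adj-InSL Q∈SL) X)

conj≡scalar⇔ : ∀ {Q T} α → InSL Q → conj Q T ≡ scalar α ⇔ T ≡ scalar α
conj≡scalar⇔ {Q} {T} α Q∈SL = mk⇔
  (λ QTQ≡α → trans (sym (conj-adj Q∈SL T))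
                    (trans (cong (conj (adj Q)) QTQ≡α) (conj-scalar (adj-InSL Q∈SL) α)))
  (λ T≡α → trans (cong (conj Q) T≡α) (conj-scalar Q∈SL α))

ℤ² : Set
ℤ² = ℤ × ℤ

infixr 6 _*ᵛ_ _⋆_
infixl 6 _ᵛ*_
infix  5 _∙_

_*ᵛ_ : Mat → ℤ² → ℤ²
mat a b c d *ᵛ (x , y) = a * x + b * y , c * x + d * y

_ᵛ*_ : ℤ² → Mat → ℤ²
(x , y) ᵛ* mat a b c d = x * a + y * c , x * b + y * d

_⋆_ : ℤ → ℤ² → ℤ²
α ⋆ (x , y) = α * x , α * y

_∙_ : ℤ² → ℤ² → ℤ
(x , y) ∙ (x′ , y′) = x * x′ + y * y′

*ᵛ-assoc : ∀ X Y v → (X · Y) *ᵛ v ≡ X *ᵛ (Y *ᵛ v)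
*ᵛ-assoc (mat a b c d) (mat e f g h) (x , y) = cong₂ _,_ (entry a b e f g h x y) (entry c d e f g h x y)
  where
  entry : ∀ a b e f g h x y →
          (a * e + b * g) * x + (a * f + b * h) * y ≡ a * (e * x + f * y) + b * (g * x + h * y)
  entry = solve-∀

ᵛ*-assoc : ∀ u X Y → u ᵛ* (X · Y) ≡ (u ᵛ* X) ᵛ* Y
ᵛ*-assoc (x , y) (mat a b c d) (mat e f g h) = cong₂ _,_ (entry a b c d e g x y) (entry a b c d f h x y)
  where
  entry : ∀ a b c d e g x y →
          x * (a * e + b * g) + y * (c * e + d * g) ≡ (x * a + y * c) * e + (x * b + y * d) * g
  entry = solve-∀

*ᵛ-⋆ : ∀ X α v → X *ᵛ (α ⋆ v) ≡ α ⋆ (X *ᵛ v)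
*ᵛ-⋆ (mat a b c d) α (x , y) = cong₂ _,_ (entry a b α x y) (entry c d α x y)
  where
  entry : ∀ a b α x y → a * (α * x) + b * (α * y) ≡ α * (a * x + b * y)
  entry = solve-∀

⋆-ᵛ* : ∀ α u X → (α ⋆ u) ᵛ* X ≡ α ⋆ (u ᵛ* X)
⋆-ᵛ* α (x , y) (mat a b c d) = cong₂ _,_ (entry a c α x y) (entry b d α x y)
  where
  entry : ∀ a c α x y → α * x * a + α * y * c ≡ α * (x * a + y * c)
  entry = solve-∀

⋆-assoc : ∀ α β v → α ⋆ (β ⋆ v) ≡ (α * β) ⋆ v
⋆-assoc α β (x , y) = cong₂ _,_ (sym (ℤ.*-assoc α β x)) (sym (ℤ.*-assoc α β y))

⋆-identityˡ : ∀ v → 1ℤ ⋆ v ≡ v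
⋆-identityˡ (x , y) = cong₂ _,_ (ℤ.*-identityˡ x) (ℤ.*-identityˡ y)

*ᵛ-identityˡ : ∀ v → idM *ᵛ v ≡ v
*ᵛ-identityˡ (x , y) = cong₂ _,_ (entry x y) (entry′ x y)
  where
  entry : ∀ x y → 1ℤ * x + 0ℤ * y ≡ x
  entry = solve-∀
  entry′ : ∀ x y → 0ℤ * x + 1ℤ * y ≡ y
  entry′ = solve-∀

ᵛ*-identityʳ : ∀ u → u ᵛ* idM ≡ u
ᵛ*-identityʳ (x , y) = cong₂ _,_ (entry x y) (entry′ x y)
  where
  entry : ∀ x y → x * 1ℤ + y * 0ℤ ≡ x
  entry = solve-∀
  entry′ : ∀ x y → x * 0ℤ + y * 1ℤ ≡ y
  entry′ = solve-∀

ᵛ*-∙ : ∀ u X v → (u ᵛ* X) ∙ v ≡ u ∙ (X *ᵛ v)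
ᵛ*-∙ (x , y) (mat a b c d) (x′ , y′) = entry a b c d x y x′ y′
  where
  entry : ∀ a b c d x y x′ y′ →
          (x * a + y * c) * x′ + (x * b + y * d) * y′ ≡ x * (a * x′ + b * y′) + y * (c * x′ + d * y′)
  entry = solve-∀

⋆-∙ : ∀ α u v → (α ⋆ u) ∙ v ≡ α * (u ∙ v)
⋆-∙ α (x , y) (x′ , y′) = entry α x y x′ y′
  where
  entry : ∀ α x y x′ y′ → α * x * x′ + α * y * y′ ≡ α * (x * x′ + y * y′)
  entry = solve-∀

∙-⋆ : ∀ u α v → u ∙ (α ⋆ v) ≡ α * (u ∙ v)
∙-⋆ (x , y) α (x′ , y′) = entry α x y x′ y′
  where
  entry : ∀ α x y x′ y′ → x * (α * x′) + y * (α * y′) ≡ α * (x * x′ + y * y′)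
  entry = solve-∀

pow-*ᵛ-eigen : ∀ {A μ v} → A *ᵛ v ≡ μ ⋆ v → ∀ n → pow A n *ᵛ v ≡ (μ ^ n) ⋆ v
pow-*ᵛ-eigen {A} {μ} {v} Av≡μv zero    = trans (*ᵛ-identityˡ v) (sym (⋆-identityˡ v))
pow-*ᵛ-eigen {A} {μ} {v} Av≡μv (suc n) = begin
  (A · pow A n) *ᵛ v    ≡⟨ *ᵛ-assoc A (pow A n) v ⟩
  A *ᵛ (pow A n *ᵛ v)   ≡⟨ cong (A *ᵛ_) (pow-*ᵛ-eigen Av≡μv n) ⟩
  A *ᵛ ((μ ^ n) ⋆ v)    ≡⟨ *ᵛ-⋆ A (μ ^ n) v ⟩
  (μ ^ n) ⋆ (A *ᵛ v)    ≡⟨ cong ((μ ^ n) ⋆_) Av≡μv ⟩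
  (μ ^ n) ⋆ (μ ⋆ v)     ≡⟨ ⋆-assoc (μ ^ n) μ v ⟩
  (μ ^ n * μ) ⋆ v       ≡⟨ cong (_⋆ v) (ℤ.*-comm (μ ^ n) μ) ⟩
  (μ * μ ^ n) ⋆ v       ∎

pow-ᵛ*-eigen : ∀ {A μ u} → u ᵛ* A ≡ μ ⋆ u → ∀ n → u ᵛ* pow A n ≡ (μ ^ n) ⋆ u
pow-ᵛ*-eigen {A} {μ} {u} uA≡μu zero    = trans (ᵛ*-identityʳ u) (sym (⋆-identityˡ u))
pow-ᵛ*-eigen {A} {μ} {u} uA≡μu (suc n) = begin
  u ᵛ* (A · pow A n)    ≡⟨ ᵛ*-assoc u A (pow A n) ⟩
  (u ᵛ* A) ᵛ* pow A n   ≡⟨ cong (_ᵛ* pow A n) uA≡μu ⟩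
  (μ ⋆ u) ᵛ* pow A n    ≡⟨ ⋆-ᵛ* μ u (pow A n) ⟩
  μ ⋆ (u ᵛ* pow A n)    ≡⟨ cong (μ ⋆_) (pow-ᵛ*-eigen uA≡μu n) ⟩
  μ ⋆ ((μ ^ n) ⋆ u)     ≡⟨ ⋆-assoc μ (μ ^ n) u ⟩
  (μ * μ ^ n) ⋆ u       ∎

0ᵛ e₁ e₂ : ℤ²
0ᵛ = 0ℤ , 0ℤ
e₁ = 1ℤ , 0ℤ
e₂ = 0ℤ , 1ℤ

*ᵛ-e₁ : ∀ X → X *ᵛ e₁ ≡ (a₁₁ X , a₂₁ X)
*ᵛ-e₁ (mat a b c d) = cong₂ _,_ (entry a b) (entry c d)
  where
  entry : ∀ x y → x * 1ℤ + y * 0ℤ ≡ x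
  entry = solve-∀

*ᵛ-e₂ : ∀ X → X *ᵛ e₂ ≡ (a₁₂ X , a₂₂ X)
*ᵛ-e₂ (mat a b c d) = cong₂ _,_ (entry a b) (entry c d)
  where
  entry : ∀ x y → x * 0ℤ + y * 1ℤ ≡ y
  entry = solve-∀

⋆-cancelˡ : ∀ {g u v} → g ≢ 0ℤ → g ⋆ u ≡ g ⋆ v → u ≡ v
⋆-cancelˡ {g} {x , y} {x′ , y′} g≢0 gu≡gv = cong₂ _,_
  (ℤ.*-cancelˡ-≡ g x x′ {{ℤ.≢-nonZero g≢0}} (cong proj₁ gu≡gv))
  (ℤ.*-cancelˡ-≡ g y y′ {{ℤ.≢-nonZero g≢0}} (cong proj₂ gu≡gv))

eigenvector-unscale : ∀ {A μ g q} → g ≢ 0ℤ → A *ᵛ (g ⋆ q) ≡ μ ⋆ (g ⋆ q) → A *ᵛ q ≡ μ ⋆ q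
eigenvector-unscale {A} {μ} {g} {q} g≢0 eigen = ⋆-cancelˡ {g} {A *ᵛ q} {μ ⋆ q} g≢0 (begin
  g ⋆ (A *ᵛ q)     ≡⟨ sym (*ᵛ-⋆ A g q) ⟩
  A *ᵛ (g ⋆ q)     ≡⟨ eigen ⟩
  μ ⋆ (g ⋆ q)      ≡⟨ ⋆-assoc μ g q ⟩
  (μ * g) ⋆ q      ≡⟨ cong (_⋆ q) (ℤ.*-comm μ g) ⟩
  (g * μ) ⋆ q      ≡⟨ sym (⋆-assoc g μ q) ⟩
  g ⋆ (μ ⋆ q)      ∎)

-- The linear representation group

Commutes : Mat → Mat → Set
Commutes X Y = X · Y ≡ Y · X

pow-commutes : ∀ {A T} → Commutes A T → ∀ n → Commutes (pow A n) T
pow-commutes {A} {T} AT≡TA zero    = trans (·-identityˡ T) (sym (·-identityʳ T))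
pow-commutes {A} {T} AT≡TA (suc n) = begin
  A · pow A n · T   ≡⟨ ·-assoc A (pow A n) T ⟩
  A · (pow A n · T) ≡⟨ cong (A ·_) (pow-commutes AT≡TA n) ⟩
  A · (T · pow A n) ≡⟨ sym (·-assoc A T (pow A n)) ⟩
  A · T · pow A n   ≡⟨ cong (_· pow A n) AT≡TA ⟩
  T · A · pow A n   ≡⟨ ·-assoc T A (pow A n) ⟩
  T · (A · pow A n) ∎

commutes⇒InN : ∀ {A T} → InGL T → Commutes A T → InN A T
commutes⇒InN {T = T} T∈GL AT≡TA = T∈GL , λ m → m , T , pow-commutes AT≡TA m

module _ {Q : Mat} (Q∈SL : InSL Q) where

  InGL-conj : ∀ {T} → InGL T → InGL (conj Q T)
  InGL-conj {T} (inj₁ detT≡1)  = inj₁ (trans (det-conj Q∈SL T) detT≡1)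
  InGL-conj {T} (inj₂ detT≡-1) = inj₂ (trans (det-conj Q∈SL T) detT≡-1)

  InN-conj : ∀ {A T} → InN A T → InN (conj Q A) (conj Q T)
  InN-conj {A} {T} (T∈GL , T-intertwines) = InGL-conj T∈GL , λ m → conjugated m (T-intertwines m)
    where
    conjugated : ∀ m → Σ ℕ (λ k → Σ Mat λ B → pow A m · B ≡ T · pow A k) →
                 Σ ℕ λ k → Σ Mat λ B → pow (conj Q A) m · B ≡ conj Q T · pow (conj Q A) k
    conjugated m (k , B , AᵐB≡TAᵏ) = k , conj Q B , (begin
      pow (conj Q A) m · conj Q B   ≡⟨ cong (_· conj Q B) (pow-conj Q∈SL A m) ⟩
      conj Q (pow A m) · conj Q B   ≡⟨ sym (conj-· Q∈SL (pow A m) B) ⟩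
      conj Q (pow A m · B)          ≡⟨ cong (conj Q) AᵐB≡TAᵏ ⟩
      conj Q (T · pow A k)          ≡⟨ conj-· Q∈SL T (pow A k) ⟩
      conj Q T · conj Q (pow A k)   ≡⟨ cong (conj Q T ·_) (sym (pow-conj Q∈SL A k)) ⟩
      conj Q T · pow (conj Q A) k   ∎)

InN-conj-⇔ : ∀ {Q A T} → InSL Q → InN A T ⇔ InN (conj Q A) (conj Q T)
InN-conj-⇔ {Q} {A} {T} Q∈SL = mk⇔ (InN-conj Q∈SL) λ h →
  subst₂ InN (conj-adj Q∈SL A) (conj-adj Q∈SL T) (InN-conj (adj-InSL Q∈SL) h)

record SubgroupIso {A B : Set} (P : A → Set) (_∙_ : A → A → A)
                   (Q : B → Set) (_⋄_ : B → B → B) : Set where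
  field
    to      : A → B
    from    : B → A
    to-Q    : ∀ {a} → P a → Q (to a)
    from-P  : ∀ {b} → Q b → P (from b)
    from-to : ∀ {a} → P a → from (to a) ≡ a
    to-from : ∀ {b} → Q b → to (from b) ≡ b
    hom     : ∀ {a a′} → P a → P a′ → to (a ∙ a′) ≡ to a ⋄ to a′

module _ {A B : Set} {P : A → Set} {_∙_ : A → A → A} {Q : B → Set} {_⋄_ : B → B → B} where

  SubgroupIso⇒GroupIso : SubgroupIso P _∙_ Q _⋄_ → GroupIso P _∙_ Q _⋄_
  SubgroupIso⇒GroupIso iso = record
    { to      = λ a _ → to a
    ; to-Q    = λ _ → to-Q
    ; from    = λ b _ → from b
    ; from-P  = λ _ → from-P
    ; from-to = λ _ → from-to
    ; to-from = λ _ → to-from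
    ; hom     = λ _ _ p p′ _ → hom p p′
    }
    where open SubgroupIso iso

  SubgroupIso-trans : ∀ {C : Set} {R : C → Set} {_⊗_ : C → C → C} →
                      SubgroupIso P _∙_ Q _⋄_ → SubgroupIso Q _⋄_ R _⊗_ → SubgroupIso P _∙_ R _⊗_
  SubgroupIso-trans iso₁ iso₂ = record
    { to      = I₂.to ∘ I₁.to
    ; from    = I₁.from ∘ I₂.from
    ; to-Q    = I₂.to-Q ∘ I₁.to-Q
    ; from-P  = I₁.from-P ∘ I₂.from-P
    ; from-to = λ p → trans (cong I₁.from (I₂.from-to (I₁.to-Q p))) (I₁.from-to p)
    ; to-from = λ r → trans (cong I₂.to (I₁.to-from (I₂.from-P r))) (I₂.to-from r)
    ; hom     = λ p p′ → trans (cong I₂.to (I₁.hom p p′)) (I₂.hom (I₁.to-Q p) (I₁.to-Q p′))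
    }
    where
    module I₁ = SubgroupIso iso₁
    module I₂ = SubgroupIso iso₂

⇔⇒SubgroupIso : ∀ {A : Set} {P Q : A → Set} {_∙_ : A → A → A} →
                (∀ {a} → P a ⇔ Q a) → SubgroupIso P _∙_ Q _∙_
⇔⇒SubgroupIso P⇔Q = record
  { to      = id
  ; from    = id
  ; to-Q    = Equivalence.to P⇔Q
  ; from-P  = Equivalence.from P⇔Q
  ; from-to = λ _ → refl
  ; to-from = λ _ → refl
  ; hom     = λ _ _ → refl
  }

conj-SubgroupIso : ∀ {Q A} → InSL Q → SubgroupIso (InN A) _·_ (InN (conj Q A)) _·_
conj-SubgroupIso {Q} {A} Q∈SL = record
  { to      = conj Q
  ; from    = conj (adj Q)
  ; to-Q    = λ {T} → InN-conj Q∈SL {A} {T}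
  ; from-P  = λ {T} → Equivalence.from (InN-conj-⇔ {Q} {A} {conj (adj Q) T} Q∈SL)
                        ∘ subst (InN (conj Q A)) (sym (conj-adj′ Q∈SL T))
  ; from-to = λ {T} _ → conj-adj Q∈SL T
  ; to-from = λ {T} _ → conj-adj′ Q∈SL T
  ; hom     = λ {T} {T′} _ _ → conj-· Q∈SL T T′
  }

-- Divisibility by all powers of a prime

∤⇒∤^ : ∀ {p n} → Prime p → ¬ p ∣ℕ n → ∀ k → ¬ p ∣ℕ n ℕ.^ k
∤⇒∤^ p-prime p∤n zero    p∣1 = ℕ.nonTrivial⇒≢1 {{prime⇒nonTrivial p-prime}} (ℕ.∣1⇒≡1 p∣1)
∤⇒∤^ {n = n} p-prime p∤n (suc k) p∣nⁿ⁺¹ with euclidsLemma n (n ℕ.^ k) p-prime p∣nⁿ⁺¹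
... | inj₁ p∣n  = p∤n p∣n
... | inj₂ p∣nᵏ = ∤⇒∤^ p-prime p∤n k p∣nᵏ

prime^∣*-cancelʳ : ∀ {p n} → Prime p → ¬ p ∣ℕ n → ∀ m x → p ℕ.^ m ∣ℕ x ℕ.* n → p ℕ.^ m ∣ℕ x
prime^∣*-cancelʳ p-prime p∤n zero    x _ = ℕ.1∣ x
prime^∣*-cancelʳ {p} {n} p-prime p∤n (suc m) x pᵐ⁺¹∣xn
  with euclidsLemma x n p-prime (ℕ.∣-trans (ℕ.m∣m*n (p ℕ.^ m)) pᵐ⁺¹∣xn)
... | inj₂ p∣n = ⊥-elim (p∤n p∣n)
... | inj₁ (ℕ.divides q refl) = subst (p ℕ.^ suc m ∣ℕ_) (ℕ.*-comm p q) (ℕ.*-monoʳ-∣ p pᵐ∣q)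
  where
  instance _ = prime⇒nonZero p-prime
  pᵐ∣q : p ℕ.^ m ∣ℕ q
  pᵐ∣q = prime^∣*-cancelʳ p-prime p∤n m q (ℕ.*-cancelˡ-∣ p (subst (p ℕ.^ suc m ∣ℕ_) (reassoc q p n) pᵐ⁺¹∣xn))
    where
    reassoc : ∀ q p n → q ℕ.* p ℕ.* n ≡ p ℕ.* (q ℕ.* n)
    reassoc q p n = trans (cong (ℕ._* n) (ℕ.*-comm q p)) (ℕ.*-assoc p q n)

n<m^n : ∀ {m} → 1 < m → ∀ n → n < m ℕ.^ n
n<m^n 1<m zero    = ℕ.z<s
n<m^n {m} 1<m (suc n) =
  ℕ.≤-<-trans (n<m^n 1<m n) (subst (m ℕ.^ n <_) (ℕ.*-comm (m ℕ.^ n) m) (ℕ.m<m*n (m ℕ.^ n) m 1<m))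
  where instance _ = ℕ.m^n≢0 m n {{ℕ.>-nonZero (ℕ.<-trans ℕ.z<s 1<m)}}

∣-all-powers⇒≡0 : ∀ {p x} → 1 < p → (∀ m → p ℕ.^ m ∣ℕ x) → x ≡ 0
∣-all-powers⇒≡0 {x = zero}  1<p pᵐ∣x = refl
∣-all-powers⇒≡0 {x = suc x} 1<p pᵐ∣x = ⊥-elim (ℕ.<⇒≱ (n<m^n 1<p (suc x)) (ℕ.∣⇒≤ (pᵐ∣x (suc x))))

∣i^n∣ : ∀ i n → ∣ i ^ n ∣ ≡ ∣ i ∣ ℕ.^ n
∣i^n∣ i zero    = refl
∣i^n∣ i (suc n) = trans (ℤ.abs-* i (i ^ n)) (cong (∣ i ∣ ℕ.*_) (∣i^n∣ i n))

^-mono-∣ : ∀ {a b} → a ∣ℕ b → ∀ m → a ℕ.^ m ∣ℕ b ℕ.^ m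
^-mono-∣ a∣b zero    = ℕ.∣-refl
^-mono-∣ a∣b (suc m) = ℕ.*-pres-∣ a∣b (^-mono-∣ a∣b m)

-- pᵐ ∣ αᵐ ∣ x γᵏ and p ∤ γᵏ give pᵐ ∣ x for every m.
αᵐ∣xγᵏ⇒x≡0 : ∀ {p α γ x} → Prime p → (+ p) ∣ α → ¬ (+ p) ∣ γ →
             (∀ m → Σ ℕ λ k → α ^ m ∣ x * γ ^ k) → x ≡ 0ℤ
αᵐ∣xγᵏ⇒x≡0 {p} {α} {γ} {x} p-prime p∣α p∤γ αᵐ∣xγᵏ =
  ℤ.∣i∣≡0⇒i≡0 (∣-all-powers⇒≡0 (ℕ.nonTrivial⇒n>1 p {{prime⇒nonTrivial p-prime}}) pᵐ∣x)
  where
  pᵐ∣x : ∀ m → p ℕ.^ m ∣ℕ ∣ x ∣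
  pᵐ∣x m with αᵐ∣xγᵏ m
  ... | k , αᵐ∣xγᵏₘ = prime^∣*-cancelʳ p-prime (∤⇒∤^ p-prime p∤γ k) m ∣ x ∣
    (ℕ.∣-trans (^-mono-∣ p∣α m) (subst₂ _∣ℕ_ (∣i^n∣ α m) ∣xγᵏ∣ αᵐ∣xγᵏₘ))
    where
    ∣xγᵏ∣ : ∣ x * γ ^ k ∣ ≡ ∣ x ∣ ℕ.* ∣ γ ∣ ℕ.^ k
    ∣xγᵏ∣ = trans (ℤ.abs-* x (γ ^ k)) (cong (∣ x ∣ ℕ.*_) (∣i^n∣ γ k))

-- The pairing of a left α-eigenvector with a right γ-eigenvector is
-- scaled by αᵐ on one side of Aᵐ B = T Aᵏ and by γᵏ on the other.
InN⇒pairing≡0 : ∀ {A T u v α γ p} → u ᵛ* A ≡ α ⋆ u → A *ᵛ v ≡ γ ⋆ v →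
                Prime p → (+ p) ∣ α → ¬ (+ p) ∣ γ → InN A T → u ∙ (T *ᵛ v) ≡ 0ℤ
InN⇒pairing≡0 {A} {T} {u} {v} {α} {γ} uA≡αu Av≡γv p-prime p∣α p∤γ (_ , T-intertwines) =
  αᵐ∣xγᵏ⇒x≡0 p-prime p∣α p∤γ λ m → divisibility m (T-intertwines m)
  where
  divisibility : ∀ m → Σ ℕ (λ k → Σ Mat λ B → pow A m · B ≡ T · pow A k) →
                 Σ ℕ λ k → α ^ m ∣ (u ∙ (T *ᵛ v)) * γ ^ k
  divisibility m (k , B , AᵐB≡TAᵏ) = k , Signed.∣⇒∣ᵤ (Signed.divides (u ∙ (B *ᵛ v)) (begin
    (u ∙ (T *ᵛ v)) * γ ^ k         ≡⟨ ℤ.*-comm (u ∙ (T *ᵛ v)) (γ ^ k) ⟩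
    γ ^ k * (u ∙ (T *ᵛ v))         ≡⟨ sym (∙-⋆ u (γ ^ k) (T *ᵛ v)) ⟩
    u ∙ ((γ ^ k) ⋆ (T *ᵛ v))       ≡⟨ cong (u ∙_) (sym (*ᵛ-⋆ T (γ ^ k) v)) ⟩
    u ∙ (T *ᵛ (γ ^ k) ⋆ v)         ≡⟨ cong (λ w → u ∙ (T *ᵛ w)) (sym (pow-*ᵛ-eigen Av≡γv k)) ⟩
    u ∙ (T *ᵛ (pow A k *ᵛ v))      ≡⟨ cong (u ∙_) (sym (*ᵛ-assoc T (pow A k) v)) ⟩
    u ∙ ((T · pow A k) *ᵛ v)       ≡⟨ cong (λ X → u ∙ (X *ᵛ v)) (sym AᵐB≡TAᵏ) ⟩
    u ∙ ((pow A m · B) *ᵛ v)       ≡⟨ cong (u ∙_) (*ᵛ-assoc (pow A m) B v) ⟩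
    u ∙ (pow A m *ᵛ (B *ᵛ v))      ≡⟨ sym (ᵛ*-∙ u (pow A m) (B *ᵛ v)) ⟩
    (u ᵛ* pow A m) ∙ (B *ᵛ v)      ≡⟨ cong (_∙ (B *ᵛ v)) (pow-ᵛ*-eigen uA≡αu m) ⟩
    ((α ^ m) ⋆ u) ∙ (B *ᵛ v)       ≡⟨ ⋆-∙ (α ^ m) u (B *ᵛ v) ⟩
    α ^ m * (u ∙ (B *ᵛ v))         ≡⟨ ℤ.*-comm (α ^ m) (u ∙ (B *ᵛ v)) ⟩
    (u ∙ (B *ᵛ v)) * α ^ m         ∎))

-- Radicals

PrimeDivisor : ℕ → ℕ → Set
PrimeDivisor n p = Prime p × p ∣ℕ n

primeDivisor? : ∀ n p → Dec (PrimeDivisor n p)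
primeDivisor? n p = prime? p ×-dec p ℕ.∣? n

infix 4 _⊆ₚ_

_⊆ₚ_ : ℕ → ℕ → Set
b ⊆ₚ a = ∀ {r} → Prime r → r ∣ℕ b → r ∣ℕ a

prime∣radℕ⇒∣ : ∀ {r n} → Prime r → r ∣ℕ radℕ n → r ∣ℕ n
prime∣radℕ⇒∣ {r} {n} r-prime r∣rad =
  proj₂ (proj₂ (∈-filter⁻ (primeDivisor? n) {xs = upTo (suc n)} r∈divisors))
  where
  r∈divisors : r ∈ filter (primeDivisor? n) (upTo (suc n))
  r∈divisors = factorisationHasAllPrimeFactors r-prime r∣rad
                 (All.map proj₁ (all-filter (primeDivisor? n) (upTo (suc n))))

prime∣⇒∣radℕ : ∀ {r n} .{{_ : ℕ.NonZero n}} → Prime r → r ∣ℕ n → r ∣ℕ radℕ n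
prime∣⇒∣radℕ r-prime r∣n =
  ∈⇒∣product (∈-filter⁺ (primeDivisor? _) (∈-upTo⁺ (ℕ.s≤s (ℕ.∣⇒≤ r∣n))) (r-prime , r∣n))

radℕ∣radℕ⇒⊆ₚ : ∀ {a b} .{{_ : ℕ.NonZero b}} → radℕ b ∣ℕ radℕ a → b ⊆ₚ a
radℕ∣radℕ⇒⊆ₚ rad∣rad r-prime r∣b =
  prime∣radℕ⇒∣ r-prime (ℕ.∣-trans (prime∣⇒∣radℕ r-prime r∣b) rad∣rad)

filter-product-∣ : ∀ {P Q : ℕ → Set} (P? : ∀ x → Dec (P x)) (Q? : ∀ x → Dec (Q x)) xs →
                   (∀ {x} → x ∈ xs → P x → Q x) → product (filter P? xs) ∣ℕ product (filter Q? xs)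
filter-product-∣ P? Q? []       P⇒Q = ℕ.∣-refl
filter-product-∣ P? Q? (x ∷ xs) P⇒Q with P? x | Q? x
... | yes px | yes _  = ℕ.*-monoʳ-∣ x (filter-product-∣ P? Q? xs (P⇒Q ∘ there))
... | yes px | no ¬qx = ⊥-elim (¬qx (P⇒Q (here refl) px))
... | no _   | yes _  = ℕ.∣n⇒∣m*n x (filter-product-∣ P? Q? xs (P⇒Q ∘ there))
... | no _   | no _   = filter-product-∣ P? Q? xs (P⇒Q ∘ there)

-- Candidates beyond n contribute nothing to the product defining radℕ n.
radℕ-extend : ∀ n .{{_ : ℕ.NonZero n}} k →
              product (filter (primeDivisor? n) (upTo (suc (n ℕ.+ k)))) ≡ radℕ n
radℕ-extend n zero    = cong (λ k → product (filter (primeDivisor? n) (upTo (suc k)))) (ℕ.+-identityʳ n)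
radℕ-extend n (suc k) = begin
  product (filter (primeDivisor? n) (upTo (suc (n ℕ.+ suc k))))
    ≡⟨ cong (λ l → product (filter (primeDivisor? n) (upTo (suc l)))) (ℕ.+-suc n k) ⟩
  product (filter (primeDivisor? n) (upTo (suc (suc N))))
    ≡⟨ cong (λ l → product (filter (primeDivisor? n) l)) (sym (List.upTo-∷ʳ (suc N))) ⟩
  product (filter (primeDivisor? n) (upTo (suc N) ++ [ suc N ]))
    ≡⟨ cong product (List.filter-++ (primeDivisor? n) (upTo (suc N)) [ suc N ]) ⟩
  product (filter (primeDivisor? n) (upTo (suc N)) ++ filter (primeDivisor? n) [ suc N ])
    ≡⟨ cong (λ l → product (filter (primeDivisor? n) (upTo (suc N)) ++ l))
            (List.filter-reject (primeDivisor? n) too-large) ⟩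
  product (filter (primeDivisor? n) (upTo (suc N)) ++ [])
    ≡⟨ cong product (List.++-identityʳ (filter (primeDivisor? n) (upTo (suc N)))) ⟩
  product (filter (primeDivisor? n) (upTo (suc N)))
    ≡⟨ radℕ-extend n k ⟩
  radℕ n ∎
  where
  N : ℕ
  N = n ℕ.+ k
  too-large : ¬ PrimeDivisor n (suc N)
  too-large (_ , N+1∣n) = ℕ.<⇒≱ (ℕ.s≤s (ℕ.m≤m+n n k)) (ℕ.∣⇒≤ N+1∣n)

⊆ₚ⇒radℕ∣radℕ : ∀ {n m} .{{_ : ℕ.NonZero n}} .{{_ : ℕ.NonZero m}} → n ⊆ₚ m → radℕ n ∣ℕ radℕ m
⊆ₚ⇒radℕ∣radℕ {n} {m} n⊆m = subst₂ _∣ℕ_ (radℕ-extend n m) radℕ-m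
  (filter-product-∣ (primeDivisor? n) (primeDivisor? m) (upTo (suc (n ℕ.+ m))) λ _ (r-prime , r∣n) →
    r-prime , n⊆m r-prime r∣n)
  where
  radℕ-m : product (filter (primeDivisor? m) (upTo (suc (n ℕ.+ m)))) ≡ radℕ m
  radℕ-m = trans (cong (λ k → product (filter (primeDivisor? m) (upTo (suc k)))) (ℕ.+-comm n m))
                 (radℕ-extend m n)

¬radℕ∣radℕ⇒prime : ∀ {n m} .{{_ : ℕ.NonZero n}} .{{_ : ℕ.NonZero m}} → ¬ radℕ n ∣ℕ radℕ m →
                   Σ ℕ λ p → Prime p × p ∣ℕ n × ¬ p ∣ℕ m
¬radℕ∣radℕ⇒prime {n} {m} ¬rad∣rad
  with any? (λ p → primeDivisor? n p ×-dec ¬? (p ℕ.∣? m)) (upTo (suc n))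
... | yes witness = extract witness
  where
  extract : ∀ {ps} → Any (λ p → PrimeDivisor n p × ¬ p ∣ℕ m) ps → Σ ℕ λ p → Prime p × p ∣ℕ n × ¬ p ∣ℕ m
  extract (here ((p-prime , p∣n) , p∤m)) = _ , p-prime , p∣n , p∤m
  extract (there witness)               = extract witness
... | no ¬witness = ⊥-elim (¬rad∣rad (⊆ₚ⇒radℕ∣radℕ n⊆m))
  where
  n⊆m : n ⊆ₚ m
  n⊆m {r} r-prime r∣n with r ℕ.∣? m
  ... | yes r∣m = r∣m
  ... | no r∤m  = ⊥-elim (¬witness (Any.map
                    (λ { refl → (r-prime , r∣n) , r∤m }) (∈-upTo⁺ (ℕ.s≤s (ℕ.∣⇒≤ r∣n)))))

⊆ₚ⇒∣^ : ∀ {a c} .{{_ : ℕ.NonZero a}} → a ⊆ₚ c → Σ ℕ λ j → a ∣ℕ c ℕ.^ j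
⊆ₚ⇒∣^ {a} {c} a⊆c = length (factors f) , subst (_∣ℕ c ℕ.^ length (factors f)) (sym (isFactorisation f))
                      (product∣^ (factors f) (factorsPrime f) (λ p∈ → ∈⇒∣product p∈))
  where
  open PrimeFactorisation
  f : PrimeFactorisation a
  f = factorise a
  product∣^ : ∀ ps → All Prime ps → (∀ {p} → p ∈ ps → p ∣ℕ product (factors f)) →
              product ps ∣ℕ c ℕ.^ length ps
  product∣^ []       All.[]            ps∣a = ℕ.∣-refl
  product∣^ (p ∷ ps) (p-prime All.∷ primes) ps∣a =
    ℕ.*-pres-∣ (a⊆c p-prime (subst (p ∣ℕ_) (sym (isFactorisation f)) (ps∣a (here refl))))
               (product∣^ ps primes (ps∣a ∘ there))

-- Integer eigenvalues

record HasEigenvalues (A : Mat) (μ₁ μ₂ : ℤ) : Set where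
  constructor eigenvalues
  field
    sum≡trace : μ₁ + μ₂ ≡ trace A
    product≡det : μ₁ * μ₂ ≡ det A

HasEigenvalues-swap : ∀ {A μ₁ μ₂} → HasEigenvalues A μ₁ μ₂ → HasEigenvalues A μ₂ μ₁
HasEigenvalues-swap {μ₁ = μ₁} {μ₂} (eigenvalues Σμ Πμ) =
  eigenvalues (trans (ℤ.+-comm μ₂ μ₁) Σμ) (trans (ℤ.*-comm μ₂ μ₁) Πμ)

-- The roots of (a₀ + a₁ x)(b₀ + b₁ x) with a₁ b₁ = 1 are - a₀ b₁ and - a₁ b₀.
reducible⇒eigenvalues : ∀ {A} → Reducible (charPoly A) → Σ ℤ λ μ₁ → Σ ℤ λ μ₂ → HasEigenvalues A μ₁ μ₂
reducible⇒eigenvalues {A} (a₀ , a₁ , b₀ , b₁ , _ , _ , factorisation) =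
  - (a₀ * b₁) , - (a₁ * b₀) , eigenvalues Σμ Πμ
  where
  Σμ : - (a₀ * b₁) + - (a₁ * b₀) ≡ trace A
  Σμ = begin
    - (a₀ * b₁) + - (a₁ * b₀) ≡⟨ solve (a₀ ∷ a₁ ∷ b₀ ∷ b₁ ∷ []) ⟩
    - (a₀ * b₁ + a₁ * b₀)     ≡⟨ cong -_ (cong c₁ factorisation) ⟩
    - - trace A               ≡⟨ ℤ.neg-involutive (trace A) ⟩
    trace A                   ∎
  Πμ : - (a₀ * b₁) * - (a₁ * b₀) ≡ det A
  Πμ = begin
    - (a₀ * b₁) * - (a₁ * b₀) ≡⟨ solve (a₀ ∷ a₁ ∷ b₀ ∷ b₁ ∷ []) ⟩
    a₀ * b₀ * (a₁ * b₁)       ≡⟨ cong₂ _*_ (cong c₀ factorisation) (cong c₂ factorisation) ⟩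
    det A * 1ℤ                ≡⟨ ℤ.*-identityʳ (det A) ⟩
    det A                     ∎

HasEigenvalues⇒IsEigenvalue : ∀ {A μ₁ μ₂} → HasEigenvalues A μ₁ μ₂ → IsEigenvalue A μ₁
HasEigenvalues⇒IsEigenvalue {A} {μ₁} {μ₂} (eigenvalues Σμ Πμ) = begin
  det A + - trace A * μ₁ + 1ℤ * (μ₁ * μ₁)
    ≡⟨ cong₂ (λ d t → d + - t * μ₁ + 1ℤ * (μ₁ * μ₁)) (sym Πμ) (sym Σμ) ⟩
  μ₁ * μ₂ + - (μ₁ + μ₂) * μ₁ + 1ℤ * (μ₁ * μ₁)
    ≡⟨ solve (μ₁ ∷ μ₂ ∷ []) ⟩
  0ℤ ∎

both∣⇒charPoly≡x² : ∀ {A μ₁ μ₂ p} → HasEigenvalues A μ₁ μ₂ → (+ p) ∣ μ₁ → (+ p) ∣ μ₂ →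
                    CongMod p (charPoly A) xSq
both∣⇒charPoly≡x² {A} {μ₁} {μ₂} {p} (eigenvalues Σμ Πμ) p∣μ₁ p∣μ₂ =
  Signed.∣⇒∣ᵤ (subst (+ p Signed.∣_) (sym (trans (ℤ.+-identityʳ (det A)) (sym Πμ)))
                 (Signed.∣m⇒∣m*n μ₂ p∣ₛμ₁)) ,
  Signed.∣⇒∣ᵤ (subst (+ p Signed.∣_) (sym (trans (ℤ.+-identityʳ (- trace A)) (cong -_ (sym Σμ))))
                 (Signed.∣m⇒∣-m (Signed.∣m∣n⇒∣m+n p∣ₛμ₁ (Signed.∣ᵤ⇒∣ {+ p} {μ₂} p∣μ₂)))) ,
  Signed.∣⇒∣ᵤ {+ p} (Signed.divides 0ℤ refl)
  where
  p∣ₛμ₁ : + p Signed.∣ μ₁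
  p∣ₛμ₁ = Signed.∣ᵤ⇒∣ p∣μ₁

prime∣*⇒∣⊎∣ : ∀ {p} x y → Prime p → (+ p) ∣ x * y → ((+ p) ∣ x) ⊎ ((+ p) ∣ y)
prime∣*⇒∣⊎∣ x y p-prime p∣xy = euclidsLemma ∣ x ∣ ∣ y ∣ p-prime (subst (_ ∣ℕ_) (ℤ.abs-* x y) p∣xy)

-- p ∣ det A = μ₁ μ₂, and p dividing both would give h_A ≡ x² (mod p).
𝒫′⇒divides-exactly-one : ∀ {A μ₁ μ₂ p} → HasEigenvalues A μ₁ μ₂ → InP′ A p →
                         (((+ p) ∣ μ₁) × ¬ ((+ p) ∣ μ₂)) ⊎ (((+ p) ∣ μ₂) × ¬ ((+ p) ∣ μ₁))
𝒫′⇒divides-exactly-one {A} {μ₁} {μ₂} {p} spec ((p-prime , p∣det) , charPoly≢x²)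
  with prime∣*⇒∣⊎∣ μ₁ μ₂ p-prime (subst ((+ p) ∣_) (sym (HasEigenvalues.product≡det spec)) p∣det)
... | inj₁ p∣μ₁ = inj₁ (p∣μ₁ , λ p∣μ₂ → charPoly≢x² (both∣⇒charPoly≡x² spec p∣μ₁ p∣μ₂))
... | inj₂ p∣μ₂ = inj₂ (p∣μ₂ , λ p∣μ₁ → charPoly≢x² (both∣⇒charPoly≡x² spec p∣μ₁ p∣μ₂))

separating-prime⇒≢ : ∀ {p μ₁ μ₂} → (+ p) ∣ μ₁ → ¬ (+ p) ∣ μ₂ → μ₁ ≢ μ₂
separating-prime⇒≢ {p} p∣μ₁ p∤μ₂ μ₁≡μ₂ = p∤μ₂ (subst ((+ p) ∣_) μ₁≡μ₂ p∣μ₁)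

𝒫′⇒distinct : ∀ {A μ₁ μ₂ p} → HasEigenvalues A μ₁ μ₂ → InP′ A p → μ₁ ≢ μ₂
𝒫′⇒distinct spec p∈𝒫′ refl with 𝒫′⇒divides-exactly-one spec p∈𝒫′
... | inj₁ (p∣μ , p∤μ) = p∤μ p∣μ
... | inj₂ (p∣μ , p∤μ) = p∤μ p∣μ

-- Triangularization over ℤ

drop-zero-summand : ∀ {x r y} → r ≡ 0ℤ → x + r ≡ y → x ≡ y
drop-zero-summand {x} r≡0 x+r≡y =
  trans (sym (ℤ.+-identityʳ x)) (trans (cong (λ r → x + r) (sym r≡0)) x+r≡y)

+-cancelʳ-≡ : ∀ {x y} z → x + z ≡ y + z → x ≡ y
+-cancelʳ-≡ {x} {y} z x+z≡y+z = begin
  x         ≡⟨ solve (x ∷ z ∷ []) ⟩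
  x + z - z ≡⟨ cong (_- z) x+z≡y+z ⟩
  y + z - z ≡⟨ solve (y ∷ z ∷ []) ⟩
  y         ∎

-- The columns of adj (A - μ) are μ-eigenvectors when μ is an eigenvalue.
adj-column₁-eigen : ∀ {a b c d μ} → IsEigenvalue (mat a b c d) μ →
                    mat a b c d *ᵛ (b , μ - a) ≡ μ ⋆ (b , μ - a)
adj-column₁-eigen {a} {b} {c} {d} {μ} root =
  cong₂ _,_ (first a b μ) (drop-zero-summand root (second a b c d μ))
  where
  first : ∀ a b μ → a * b + b * (μ - a) ≡ μ * b
  first = solve-∀
  second : ∀ a b c d μ →
           c * b + d * (μ - a) + (a * d - b * c + - (a + d) * μ + 1ℤ * (μ * μ)) ≡ μ * (μ - a)
  second = solve-∀

adj-column₂-eigen : ∀ {a b c d μ} → IsEigenvalue (mat a b c d) μ →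
                    mat a b c d *ᵛ (μ - d , c) ≡ μ ⋆ (μ - d , c)
adj-column₂-eigen {a} {b} {c} {d} {μ} root =
  cong₂ _,_ (drop-zero-summand root (first a b c d μ)) (second c d μ)
  where
  first : ∀ a b c d μ →
          a * (μ - d) + b * c + (a * d - b * c + - (a + d) * μ + 1ℤ * (μ * μ)) ≡ μ * (μ - d)
  first = solve-∀
  second : ∀ c d μ → c * (μ - d) + d * c ≡ μ * c
  second = solve-∀

adj-columns≡0⇒equal : ∀ {a b c d μ₁ μ₂} → HasEigenvalues (mat a b c d) μ₁ μ₂ →
                      (b , μ₂ - a) ≡ 0ᵛ → (μ₂ - d , c) ≡ 0ᵛ → μ₁ ≡ μ₂
adj-columns≡0⇒equal {a} {b} {c} {d} {μ₁} {μ₂} (eigenvalues Σμ _) refl≡ refl≡′ =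
  +-cancelʳ-≡ μ₂ (trans Σμ (cong₂ _+_ (sym (ℤ.i-j≡0⇒i≡j μ₂ a (cong proj₂ refl≡)))
                                      (sym (ℤ.i-j≡0⇒i≡j μ₂ d (cong proj₁ refl≡′)))))

eigenvector : ∀ {A μ₁ μ₂} → HasEigenvalues A μ₁ μ₂ → μ₁ ≢ μ₂ →
              Σ ℤ² λ v → v ≢ 0ᵛ × A *ᵛ v ≡ μ₂ ⋆ v
eigenvector {mat a b c d} {μ₁} {μ₂} spec μ₁≢μ₂ =
  pick (≡-dec ℤ._≟_ ℤ._≟_ (b , μ₂ - a) 0ᵛ) (≡-dec ℤ._≟_ ℤ._≟_ (μ₂ - d , c) 0ᵛ)
  where
  root : IsEigenvalue (mat a b c d) μ₂
  root = HasEigenvalues⇒IsEigenvalue (HasEigenvalues-swap spec)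
  pick : Dec ((b , μ₂ - a) ≡ 0ᵛ) → Dec ((μ₂ - d , c) ≡ 0ᵛ) →
         Σ ℤ² λ v → v ≢ 0ᵛ × mat a b c d *ᵛ v ≡ μ₂ ⋆ v
  pick (no v≢0)  _         = (b , μ₂ - a) , v≢0 , adj-column₁-eigen {a} {b} {c} {d} root
  pick (yes _)   (no w≢0)  = (μ₂ - d , c) , w≢0 , adj-column₂-eigen {a} {b} {c} {d} root
  pick (yes v≡0) (yes w≡0) = ⊥-elim (μ₁≢μ₂ (adj-columns≡0⇒equal spec v≡0 w≡0))

+∣x∣≡σx : ∀ x → Σ ℤ λ σ → + ∣ x ∣ ≡ σ * x
+∣x∣≡σx (+ n)    = 1ℤ , sym (ℤ.*-identityˡ (+ n))
+∣x∣≡σx -[1+ n ] = -1ℤ , sym (ℤ.-1*i≡-i -[1+ n ])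

ℕ-bézout⇒ℤ : ∀ {d X Y m n} → d ℕ.+ Y ℕ.* n ≡ X ℕ.* m → + X * + m - + Y * + n ≡ + d
ℕ-bézout⇒ℤ {d} {X} {Y} {m} {n} eq = begin
  + X * + m - + Y * + n             ≡⟨ cong (_- + Y * + n) (sym lifted) ⟩
  + d + + Y * + n - + Y * + n       ≡⟨ cancel (+ d) (+ Y * + n) ⟩
  + d                               ∎
  where
  cancel : ∀ a b → a + b - b ≡ a
  cancel = solve-∀
  lifted : + d + + Y * + n ≡ + X * + m
  lifted = begin
    + d + + Y * + n   ≡⟨ cong (λ z → + d + z) (sym (ℤ.pos-* Y n)) ⟩
    + d + + (Y ℕ.* n) ≡⟨ sym (ℤ.pos-+ d (Y ℕ.* n)) ⟩
    + (d ℕ.+ Y ℕ.* n) ≡⟨ cong +_ eq ⟩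
    + (X ℕ.* m)       ≡⟨ ℤ.pos-* X m ⟩
    + X * + m         ∎

bézout : ∀ x y → Σ ℤ λ u → Σ ℤ λ w → u * x + w * y ≡ gcd x y
bézout x y with Bézout.identity (gcd-GCD ∣ x ∣ ∣ y ∣) | +∣x∣≡σx x | +∣x∣≡σx y
... | Bézout.+- X Y eq | σ , ∣x∣≡σx | τ , ∣y∣≡τy = + X * σ , - (+ Y * τ) , (begin
  + X * σ * x + - (+ Y * τ) * y ≡⟨ regroup (+ X) σ x (+ Y) τ y ⟩
  + X * (σ * x) - + Y * (τ * y) ≡⟨ cong₂ (λ m n → + X * m - + Y * n) (sym ∣x∣≡σx) (sym ∣y∣≡τy) ⟩
  + X * + ∣ x ∣ - + Y * + ∣ y ∣ ≡⟨ ℕ-bézout⇒ℤ {X = X} {Y} {∣ x ∣} {∣ y ∣} eq ⟩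
  gcd x y                       ∎)
  where
  regroup : ∀ X σ x Y τ y → X * σ * x + - (Y * τ) * y ≡ X * (σ * x) - Y * (τ * y)
  regroup = solve-∀
... | Bézout.-+ X Y eq | σ , ∣x∣≡σx | τ , ∣y∣≡τy = - (+ X * σ) , + Y * τ , (begin
  - (+ X * σ) * x + + Y * τ * y ≡⟨ regroup (+ X) σ x (+ Y) τ y ⟩
  + Y * (τ * y) - + X * (σ * x) ≡⟨ cong₂ (λ n m → + Y * n - + X * m) (sym ∣y∣≡τy) (sym ∣x∣≡σx) ⟩
  + Y * + ∣ y ∣ - + X * + ∣ x ∣ ≡⟨ ℕ-bézout⇒ℤ {X = Y} {X} {∣ y ∣} {∣ x ∣} eq ⟩
  gcd x y                       ∎)
  where
  regroup : ∀ X σ x Y τ y → - (X * σ) * x + Y * τ * y ≡ Y * (τ * y) - X * (σ * x)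
  regroup = solve-∀

-- Dividing v by the gcd g of its entries gives a primitive vector q, and
-- a Bézout relation u q₁ + w q₂ = 1 completes q to a basis of ℤ².
completion : ∀ v → v ≢ 0ᵛ → Σ ℤ λ g → Σ Mat λ Q → g ≢ 0ℤ × InSL Q × v ≡ g ⋆ (Q *ᵛ e₂)
completion (x , y) v≢0
  with bézout x y | Signed.∣ᵤ⇒∣ {gcd x y} {x} (gcd[i,j]∣i x y) | Signed.∣ᵤ⇒∣ {gcd x y} {y} (gcd[i,j]∣j x y)
... | u , w , ux+wy≡g | Signed.divides q₁ x≡q₁g | Signed.divides q₂ y≡q₂g =
  g , mat w q₁ (- u) q₂ , g≢0 , mkSL (trans (det-entry w q₁ u q₂) unimodular) ,
  cong₂ _,_ (trans x≡q₁g (column q₁ g w)) (trans y≡q₂g (column q₂ g (- u)))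
  where
  g : ℤ
  g = gcd x y
  g≢0 : g ≢ 0ℤ
  g≢0 g≡0 = v≢0 (cong₂ _,_ (gcd[i,j]≡0⇒i≡0 x y g≡0) (gcd[i,j]≡0⇒j≡0 {x} g≡0))
  distribute : ∀ u q₁ w q₂ g → (u * q₁ + w * q₂) * g ≡ u * (q₁ * g) + w * (q₂ * g)
  distribute = solve-∀
  unimodular : u * q₁ + w * q₂ ≡ 1ℤ
  unimodular = ℤ.*-cancelʳ-≡ _ _ g {{ℤ.≢-nonZero g≢0}} (begin
    (u * q₁ + w * q₂) * g     ≡⟨ distribute u q₁ w q₂ g ⟩
    u * (q₁ * g) + w * (q₂ * g) ≡⟨ cong₂ (λ m n → u * m + w * n) (sym x≡q₁g) (sym y≡q₂g) ⟩
    u * x + w * y             ≡⟨ ux+wy≡g ⟩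
    g                         ≡⟨ sym (ℤ.*-identityˡ g) ⟩
    1ℤ * g                    ∎)
  det-entry : ∀ w q₁ u q₂ → w * q₂ - q₁ * - u ≡ u * q₁ + w * q₂
  det-entry = solve-∀
  column : ∀ q g w → q * g ≡ g * (w * 0ℤ + q * 1ℤ)
  column = solve-∀

conj-eigenvector : ∀ {Q A μ w} → InSL Q → A *ᵛ (Q *ᵛ w) ≡ μ ⋆ (Q *ᵛ w) → conj Q A *ᵛ w ≡ μ ⋆ w
conj-eigenvector {Q} {A} {μ} {w} Q∈SL AQw≡μQw = begin
  (adj Q · A · Q) *ᵛ w       ≡⟨ *ᵛ-assoc (adj Q · A) Q w ⟩
  (adj Q · A) *ᵛ (Q *ᵛ w)    ≡⟨ *ᵛ-assoc (adj Q) A (Q *ᵛ w) ⟩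
  adj Q *ᵛ (A *ᵛ (Q *ᵛ w))   ≡⟨ cong (adj Q *ᵛ_) AQw≡μQw ⟩
  adj Q *ᵛ (μ ⋆ (Q *ᵛ w))    ≡⟨ *ᵛ-⋆ (adj Q) μ (Q *ᵛ w) ⟩
  μ ⋆ (adj Q *ᵛ (Q *ᵛ w))    ≡⟨ cong (μ ⋆_) (sym (*ᵛ-assoc (adj Q) Q w)) ⟩
  μ ⋆ ((adj Q · Q) *ᵛ w)     ≡⟨ cong (λ X → μ ⋆ (X *ᵛ w)) (adj-inverseˡ Q∈SL) ⟩
  μ ⋆ (idM *ᵛ w)             ≡⟨ cong (μ ⋆_) (*ᵛ-identityˡ w) ⟩
  μ ⋆ w                      ∎

lower : ℤ → ℤ → ℤ → Mat
lower μ₁ c μ₂ = mat μ₁ 0ℤ c μ₂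

lower-from-column₂ : ∀ {X μ₁ μ₂} → X *ᵛ e₂ ≡ μ₂ ⋆ e₂ → trace X ≡ μ₁ + μ₂ → X ≡ lower μ₁ (a₂₁ X) μ₂
lower-from-column₂ {X@(mat a b c d)} {μ₁} {μ₂} Xe₂≡μ₂e₂ trX≡μ₁+μ₂ = mat-≡ a≡μ₁ b≡0 refl d≡μ₂
  where
  column₂ : (b , d) ≡ (μ₂ * 0ℤ , μ₂ * 1ℤ)
  column₂ = trans (sym (*ᵛ-e₂ X)) Xe₂≡μ₂e₂
  b≡0 : b ≡ 0ℤ
  b≡0 = trans (cong proj₁ column₂) (ℤ.*-zeroʳ μ₂)
  d≡μ₂ : d ≡ μ₂
  d≡μ₂ = trans (cong proj₂ column₂) (ℤ.*-identityʳ μ₂)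
  a≡μ₁ : a ≡ μ₁
  a≡μ₁ = +-cancelʳ-≡ μ₂ (trans (cong (λ z → a + z) (sym d≡μ₂)) trX≡μ₁+μ₂)

record Triangularization (A : Mat) (μ₁ μ₂ : ℤ) : Set where
  field
    Q          : Mat
    c          : ℤ
    Q∈SL       : InSL Q
    conj≡lower : conj Q A ≡ lower μ₁ c μ₂

primitive-eigenvector : ∀ {A μ₁ μ₂} → HasEigenvalues A μ₁ μ₂ → μ₁ ≢ μ₂ →
                        Σ Mat λ Q → InSL Q × A *ᵛ (Q *ᵛ e₂) ≡ μ₂ ⋆ (Q *ᵛ e₂)
primitive-eigenvector {A} {μ₁} {μ₂} spec μ₁≢μ₂ =
  let v , v≢0 , Av≡μ₂v        = eigenvector spec μ₁≢μ₂
      g , Q , g≢0 , Q∈SL , v≡gq = completion v v≢0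
  in Q , Q∈SL , eigenvector-unscale {A} {μ₂} {g} {Q *ᵛ e₂} g≢0
                  (subst (λ w → A *ᵛ w ≡ μ₂ ⋆ w) v≡gq Av≡μ₂v)

triangularize : ∀ {A μ₁ μ₂} → HasEigenvalues A μ₁ μ₂ → μ₁ ≢ μ₂ → Triangularization A μ₁ μ₂
triangularize {A} {μ₁} {μ₂} spec μ₁≢μ₂ =
  let Q , Q∈SL , AQe₂≡μ₂Qe₂ = primitive-eigenvector spec μ₁≢μ₂
  in record
    { Q          = Q
    ; c          = a₂₁ (conj Q A)
    ; Q∈SL       = Q∈SL
    ; conj≡lower = lower-from-column₂ {conj Q A} (conj-eigenvector {Q} {A} {μ₂} {e₂} Q∈SL AQe₂≡μ₂Qe₂)
                     (trans (trace-conj Q∈SL A) (sym (HasEigenvalues.sum≡trace spec)))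
    }

-- Diagonalizing the transpose

TransposeDiagonalizable∣2 : Mat → Set
TransposeDiagonalizable∣2 A =
  Σ Mat λ M → Σ Mat λ D → IsDiagonal D × (transpose A · M ≡ M · D) × (det M ∣ + 2)

diagonalizing-columns : ∀ {A M D} → IsDiagonal D → A · M ≡ M · D →
                        A *ᵛ (a₁₁ M , a₂₁ M) ≡ a₁₁ D ⋆ (a₁₁ M , a₂₁ M) ×
                        A *ᵛ (a₁₂ M , a₂₂ M) ≡ a₂₂ D ⋆ (a₁₂ M , a₂₂ M)
diagonalizing-columns {A} {M} {D@(mat d₁ .0ℤ .0ℤ d₂)} (refl , refl) AM≡MD =
  subst (λ m → A *ᵛ m ≡ d₁ ⋆ m) (*ᵛ-e₁ M) (column e₁ d₁ (cong₂ _,_ (diagonal₁ d₁) (off-diagonal₁ d₂ d₁))) ,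
  subst (λ m → A *ᵛ m ≡ d₂ ⋆ m) (*ᵛ-e₂ M) (column e₂ d₂ (cong₂ _,_ (off-diagonal₂ d₁ d₂) (diagonal₂ d₂)))
  where
  diagonal₁ : ∀ d → d * 1ℤ + 0ℤ * 0ℤ ≡ d * 1ℤ
  diagonal₁ = solve-∀
  off-diagonal₁ : ∀ d d′ → 0ℤ * 1ℤ + d * 0ℤ ≡ d′ * 0ℤ
  off-diagonal₁ = solve-∀
  off-diagonal₂ : ∀ d d′ → d * 0ℤ + 0ℤ * 1ℤ ≡ d′ * 0ℤ
  off-diagonal₂ = solve-∀
  diagonal₂ : ∀ d → 0ℤ * 0ℤ + d * 1ℤ ≡ d * 1ℤ
  diagonal₂ = solve-∀
  column : ∀ w μ → D *ᵛ w ≡ μ ⋆ w → A *ᵛ (M *ᵛ w) ≡ μ ⋆ (M *ᵛ w)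
  column w μ Dw≡μw = begin
    A *ᵛ (M *ᵛ w)    ≡⟨ sym (*ᵛ-assoc A M w) ⟩
    (A · M) *ᵛ w     ≡⟨ cong (_*ᵛ w) AM≡MD ⟩
    (M · D) *ᵛ w     ≡⟨ *ᵛ-assoc M D w ⟩
    M *ᵛ (D *ᵛ w)    ≡⟨ cong (M *ᵛ_) Dw≡μw ⟩
    M *ᵛ (μ ⋆ w)     ≡⟨ *ᵛ-⋆ M μ w ⟩
    μ ⋆ (M *ᵛ w)     ∎

TransposeDiagonalizable∣2-conj : ∀ {Q A} → InSL Q → TransposeDiagonalizable∣2 A →
                                 TransposeDiagonalizable∣2 (conj Q A)
TransposeDiagonalizable∣2-conj {Q} {A} Q∈SL (M , D , D-diagonal , AᵗM≡MD , detM∣2) =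
  Qᵗ · M , D , D-diagonal , eigen , subst (_∣ + 2) (sym det-QᵗM) detM∣2
  where
  Qᵗ Aᵗ adjQᵗ : Mat
  Qᵗ = transpose Q
  Aᵗ = transpose A
  adjQᵗ = transpose (adj Q)
  eigen : transpose (conj Q A) · (Qᵗ · M) ≡ Qᵗ · M · D
  eigen = begin
    transpose (adj Q · A · Q) · (Qᵗ · M)    ≡⟨ cong (_· (Qᵗ · M)) (transpose-· (adj Q · A) Q) ⟩
    Qᵗ · transpose (adj Q · A) · (Qᵗ · M)   ≡⟨ cong (λ X → Qᵗ · X · (Qᵗ · M)) (transpose-· (adj Q) A) ⟩
    Qᵗ · (Aᵗ · adjQᵗ) · (Qᵗ · M)            ≡⟨ ·-assoc Qᵗ (Aᵗ · adjQᵗ) (Qᵗ · M) ⟩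
    Qᵗ · ((Aᵗ · adjQᵗ) · (Qᵗ · M))          ≡⟨ cong (Qᵗ ·_) (cancel-middle adjQᵗQᵗ≡id Aᵗ M) ⟩
    Qᵗ · (Aᵗ · M)                           ≡⟨ cong (Qᵗ ·_) AᵗM≡MD ⟩
    Qᵗ · (M · D)                            ≡⟨ sym (·-assoc Qᵗ M D) ⟩
    Qᵗ · M · D                              ∎
    where
    adjQᵗQᵗ≡id : adjQᵗ · Qᵗ ≡ idM
    adjQᵗQᵗ≡id = trans (sym (transpose-· Q (adj Q))) (cong transpose (adj-inverseʳ Q∈SL))
  det-QᵗM : det (Qᵗ · M) ≡ det M
  det-QᵗM = begin
    det (Qᵗ · M)      ≡⟨ det-· Qᵗ M ⟩
    det Qᵗ * det M    ≡⟨ cong (_* det M) (trans (det-transpose Q) (InSL.det≡1 Q∈SL)) ⟩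
    1ℤ * det M        ≡⟨ ℤ.*-identityˡ (det M) ⟩
    det M             ∎

TransposeDiagonalizable∣2-conj-⇔ : ∀ {Q A} → InSL Q →
                                   TransposeDiagonalizable∣2 A ⇔ TransposeDiagonalizable∣2 (conj Q A)
TransposeDiagonalizable∣2-conj-⇔ {Q} {A} Q∈SL = mk⇔ (TransposeDiagonalizable∣2-conj Q∈SL) λ h →
  subst TransposeDiagonalizable∣2 (conj-adj Q∈SL A) (TransposeDiagonalizable∣2-conj (adj-InSL Q∈SL) h)

∣2⇒≢0 : ∀ {z} → z ∣ + 2 → z ≢ 0ℤ
∣2⇒≢0 0∣2 refl with ℕ.0∣⇒≡0 0∣2
... | ()

IsUnit : ℤ → Set
IsUnit t = t ≡ 1ℤ ⊎ t ≡ -1ℤ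

isNegative : ℤ → Bool
isNegative (+ _)    = false
isNegative -[1+ _ ] = true

∣t∣≡1⇒IsUnit : ∀ {t} → ∣ t ∣ ≡ 1 → IsUnit t
∣t∣≡1⇒IsUnit {+ .1}     refl = inj₁ refl
∣t∣≡1⇒IsUnit { -[1+ 0 ]} refl = inj₂ refl

InGL-lower⇒IsUnit : ∀ {t s t′} → InGL (mat t 0ℤ s t′) → IsUnit t × IsUnit t′
InGL-lower⇒IsUnit {t} {s} {t′} T∈GL =
  ∣t∣≡1⇒IsUnit (ℕ.m*n≡1⇒m≡1 ∣ t ∣ ∣ t′ ∣ ∣t∣∣t′∣≡1) , ∣t∣≡1⇒IsUnit (ℕ.m*n≡1⇒n≡1 ∣ t ∣ ∣ t′ ∣ ∣t∣∣t′∣≡1)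
  where
  det≡tt′ : t * t′ - 0ℤ * s ≡ t * t′
  det≡tt′ = solve (t ∷ t′ ∷ s ∷ [])
  ∣det∣≡1 : InGL (mat t 0ℤ s t′) → ∣ t * t′ - 0ℤ * s ∣ ≡ 1
  ∣det∣≡1 (inj₁ detT≡1)  = cong ∣_∣ detT≡1
  ∣det∣≡1 (inj₂ detT≡-1) = cong ∣_∣ detT≡-1
  ∣t∣∣t′∣≡1 : ∣ t ∣ ℕ.* ∣ t′ ∣ ≡ 1
  ∣t∣∣t′∣≡1 = trans (sym (ℤ.abs-* t t′)) (trans (cong ∣_∣ (sym det≡tt′)) (∣det∣≡1 T∈GL))

isNegative-* : ∀ {t u} → IsUnit t → IsUnit u → isNegative (t * u) ≡ isNegative t xor isNegative u
isNegative-* (inj₁ refl) (inj₁ refl) = refl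
isNegative-* (inj₁ refl) (inj₂ refl) = refl
isNegative-* (inj₂ refl) (inj₁ refl) = refl
isNegative-* (inj₂ refl) (inj₂ refl) = refl

isNegative-injective : ∀ {t u} → IsUnit t → IsUnit u → isNegative t ≡ isNegative u → t ≡ u
isNegative-injective (inj₁ refl) (inj₁ refl) _ = refl
isNegative-injective (inj₂ refl) (inj₂ refl) _ = refl
isNegative-injective (inj₁ refl) (inj₂ refl) ()
isNegative-injective (inj₂ refl) (inj₁ refl) ()

-- The lower-triangular form

module LowerTriangular (μ₁ c μ₂ : ℤ) where

  L : Mat
  L = lower μ₁ c μ₂

  u₂ v₁ : ℤ²
  u₂ = c , μ₂ - μ₁
  v₁ = μ₁ - μ₂ , c

  e₁-left-eigen : e₁ ᵛ* L ≡ μ₁ ⋆ e₁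
  e₁-left-eigen = cong₂ _,_ (entry μ₁ c) (entry′ μ₁ μ₂)
    where
    entry : ∀ μ₁ c → 1ℤ * μ₁ + 0ℤ * c ≡ μ₁ * 1ℤ
    entry = solve-∀
    entry′ : ∀ μ₁ μ₂ → 1ℤ * 0ℤ + 0ℤ * μ₂ ≡ μ₁ * 0ℤ
    entry′ = solve-∀

  e₂-right-eigen : L *ᵛ e₂ ≡ μ₂ ⋆ e₂
  e₂-right-eigen = cong₂ _,_ (entry μ₁ μ₂) (entry′ c μ₂)
    where
    entry : ∀ μ₁ μ₂ → μ₁ * 0ℤ + 0ℤ * 1ℤ ≡ μ₂ * 0ℤ
    entry = solve-∀
    entry′ : ∀ c μ → c * 0ℤ + μ * 1ℤ ≡ μ * 1ℤ
    entry′ = solve-∀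

  u₂-left-eigen : u₂ ᵛ* L ≡ μ₂ ⋆ u₂
  u₂-left-eigen = cong₂ _,_ (entry μ₁ c μ₂) (entry′ μ₁ c μ₂)
    where
    entry : ∀ μ₁ c μ₂ → c * μ₁ + (μ₂ - μ₁) * c ≡ μ₂ * c
    entry = solve-∀
    entry′ : ∀ μ₁ c μ₂ → c * 0ℤ + (μ₂ - μ₁) * μ₂ ≡ μ₂ * (μ₂ - μ₁)
    entry′ = solve-∀

  v₁-right-eigen : L *ᵛ v₁ ≡ μ₁ ⋆ v₁
  v₁-right-eigen = cong₂ _,_ (entry μ₁ c μ₂) (entry′ μ₁ c μ₂)
    where
    entry : ∀ μ₁ c μ₂ → μ₁ * (μ₁ - μ₂) + 0ℤ * c ≡ μ₁ * (μ₁ - μ₂)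
    entry = solve-∀
    entry′ : ∀ μ₁ c μ₂ → c * (μ₁ - μ₂) + μ₂ * c ≡ μ₁ * c
    entry′ = solve-∀

  e₁∙Te₂≡a₁₂ : ∀ T → e₁ ∙ (T *ᵛ e₂) ≡ a₁₂ T
  e₁∙Te₂≡a₁₂ (mat a b c d) = entry a b c d
    where
    entry : ∀ a b c d → 1ℤ * (a * 0ℤ + b * 1ℤ) + 0ℤ * (c * 0ℤ + d * 1ℤ) ≡ b
    entry = solve-∀

  InN⇒upper≡0 : ∀ {p T} → Prime p → (+ p) ∣ μ₁ → ¬ (+ p) ∣ μ₂ → InN L T → a₁₂ T ≡ 0ℤ
  InN⇒upper≡0 {T = T} p-prime p∣μ₁ p∤μ₂ T∈N =
    trans (sym (e₁∙Te₂≡a₁₂ T))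
          (InN⇒pairing≡0 {L} {T} {e₁} {e₂} {μ₁} {μ₂} e₁-left-eigen e₂-right-eigen p-prime p∣μ₁ p∤μ₂ T∈N)

  InN⇒u₂Tv₁≡0 : ∀ {q T} → Prime q → (+ q) ∣ μ₂ → ¬ (+ q) ∣ μ₁ → InN L T → u₂ ∙ (T *ᵛ v₁) ≡ 0ℤ
  InN⇒u₂Tv₁≡0 {T = T} = InN⇒pairing≡0 {L} {T} {u₂} {v₁} {μ₂} {μ₁} u₂-left-eigen v₁-right-eigen

  -- The (2,1) entry of L T - T L.
  commutator₂₁ : Mat → ℤ
  commutator₂₁ T = c * (a₁₁ T - a₂₂ T) - a₂₁ T * (μ₁ - μ₂)

  u₂Tv₁≡δ·commutator₂₁ : ∀ {T} → a₁₂ T ≡ 0ℤ → u₂ ∙ (T *ᵛ v₁) ≡ (μ₁ - μ₂) * commutator₂₁ T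
  u₂Tv₁≡δ·commutator₂₁ {mat t .0ℤ s t′} refl = entry μ₁ c μ₂ t s t′
    where
    entry : ∀ μ₁ c μ₂ t s t′ → c * (t * (μ₁ - μ₂) + 0ℤ * c) + (μ₂ - μ₁) * (s * (μ₁ - μ₂) + t′ * c)
                              ≡ (μ₁ - μ₂) * (c * (t - t′) - s * (μ₁ - μ₂))
    entry = solve-∀

  commutes⇔ : ∀ {T} → μ₁ ≢ μ₂ → Commutes L T ⇔ (a₁₂ T ≡ 0ℤ × commutator₂₁ T ≡ 0ℤ)
  commutes⇔ {mat t b s t′} μ₁≢μ₂ = mk⇔ to from
    where
    upper : ∀ μ₁ μ₂ t b t′ → μ₁ * b + 0ℤ * t′ - (t * 0ℤ + b * μ₂) ≡ b * (μ₁ - μ₂)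
    upper = solve-∀
    lower-left : ∀ μ₁ c μ₂ t s t′ → c * t + μ₂ * s - (s * μ₁ + t′ * c) ≡ c * (t - t′) - s * (μ₁ - μ₂)
    lower-left = solve-∀
    diagonal₁ : ∀ μ₁ c t s → μ₁ * t + 0ℤ * s ≡ t * μ₁ + 0ℤ * c
    diagonal₁ = solve-∀
    diagonal₂ : ∀ c μ₂ s t′ → c * 0ℤ + μ₂ * t′ ≡ s * 0ℤ + t′ * μ₂
    diagonal₂ = solve-∀
    zeros : ∀ μ₁ μ₂ t t′ → μ₁ * 0ℤ + 0ℤ * t′ ≡ t * 0ℤ + 0ℤ * μ₂
    zeros = solve-∀
    to : Commutes L (mat t b s t′) → b ≡ 0ℤ × c * (t - t′) - s * (μ₁ - μ₂) ≡ 0ℤ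
    to LT≡TL with ℤ.i*j≡0⇒i≡0∨j≡0 b (trans (sym (upper μ₁ μ₂ t b t′)) (ℤ.i≡j⇒i-j≡0 (cong a₁₂ LT≡TL)))
    ... | inj₁ b≡0 = b≡0 , trans (sym (lower-left μ₁ c μ₂ t s t′)) (ℤ.i≡j⇒i-j≡0 (cong a₂₁ LT≡TL))
    ... | inj₂ δ≡0 = ⊥-elim (μ₁≢μ₂ (ℤ.i-j≡0⇒i≡j μ₁ μ₂ δ≡0))
    from : b ≡ 0ℤ × c * (t - t′) - s * (μ₁ - μ₂) ≡ 0ℤ → Commutes L (mat t b s t′)
    from (refl , commutator≡0) = mat-≡ (diagonal₁ μ₁ c t s) (zeros μ₁ μ₂ t t′)
      (ℤ.i-j≡0⇒i≡j _ _ (trans (lower-left μ₁ c μ₂ t s t′) commutator≡0)) (diagonal₂ c μ₂ s t′)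

  u₂Tv₁≡0⇒commutes : ∀ {T} → μ₁ ≢ μ₂ → a₁₂ T ≡ 0ℤ → u₂ ∙ (T *ᵛ v₁) ≡ 0ℤ → Commutes L T
  u₂Tv₁≡0⇒commutes {T} μ₁≢μ₂ a₁₂≡0 u₂Tv₁≡0
    with ℤ.i*j≡0⇒i≡0∨j≡0 (μ₁ - μ₂) (trans (sym (u₂Tv₁≡δ·commutator₂₁ {T} a₁₂≡0)) u₂Tv₁≡0)
  ... | inj₁ δ≡0 = ⊥-elim (μ₁≢μ₂ (ℤ.i-j≡0⇒i≡j μ₁ μ₂ δ≡0))
  ... | inj₂ commutator≡0 = Equivalence.from (commutes⇔ {T} μ₁≢μ₂) (a₁₂≡0 , commutator≡0)

  InCentralizer : Mat → Set
  InCentralizer T = InGL T × Commutes L T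

  InN⇔InCentralizer : ∀ {p q T} → Prime p → (+ p) ∣ μ₁ → ¬ (+ p) ∣ μ₂ →
                      Prime q → (+ q) ∣ μ₂ → ¬ (+ q) ∣ μ₁ → InN L T ⇔ InCentralizer T
  InN⇔InCentralizer {p} {q} {T} p-prime p∣μ₁ p∤μ₂ q-prime q∣μ₂ q∤μ₁ = mk⇔
    (λ T∈N → proj₁ T∈N , u₂Tv₁≡0⇒commutes {T} μ₁≢μ₂ (InN⇒upper≡0 {T = T} p-prime p∣μ₁ p∤μ₂ T∈N)
                                                     (InN⇒u₂Tv₁≡0 {T = T} q-prime q∣μ₂ q∤μ₁ T∈N))
    (λ (T∈GL , LT≡TL) → commutes⇒InN {L} {T} T∈GL LT≡TL)
    where
    μ₁≢μ₂ : μ₁ ≢ μ₂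
    μ₁≢μ₂ = separating-prime⇒≢ p∣μ₁ p∤μ₂

  scalar-InCentralizer : ∀ {α} → InGL (scalar α) → InCentralizer (scalar α)
  scalar-InCentralizer {α} α∈GL = α∈GL , scalar-comm α L

  module _ (μ₁≢μ₂ : μ₁ ≢ μ₂) where

    private
      commutator≡0 : ∀ {T} → InCentralizer T → commutator₂₁ T ≡ 0ℤ
      commutator≡0 (_ , LT≡TL) = proj₂ (Equivalence.to (commutes⇔ μ₁≢μ₂) LT≡TL)

    InCentralizer⇒lower : ∀ {T} → InCentralizer T → a₁₂ T ≡ 0ℤ
    InCentralizer⇒lower (_ , LT≡TL) = proj₁ (Equivalence.to (commutes⇔ μ₁≢μ₂) LT≡TL)

    signs : Mat → V4
    signs T = isNegative (a₁₁ T) , isNegative (a₂₂ T)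

    -- The diagonal of a centralizing T determines T: its (2,1) entry is
    -- fixed by the commutator relation s (μ₁ - μ₂) = c (t - t′).
    signs-injective : ∀ {T T′} → InCentralizer T → InCentralizer T′ → signs T ≡ signs T′ → T ≡ T′
    signs-injective {mat t b s t′} {mat u b′ r u′} T∈C T′∈C signs≡
      with InCentralizer⇒lower T∈C | InCentralizer⇒lower T′∈C
    ... | refl | refl = mat-≡ t≡u refl s≡r t′≡u′
      where
      T-units : IsUnit t × IsUnit t′
      T-units = InGL-lower⇒IsUnit {t} {s} {t′} (proj₁ T∈C)
      T′-units : IsUnit u × IsUnit u′
      T′-units = InGL-lower⇒IsUnit {u} {r} {u′} (proj₁ T′∈C)
      t≡u : t ≡ u
      t≡u = isNegative-injective (proj₁ T-units) (proj₁ T′-units) (cong proj₁ signs≡)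
      t′≡u′ : t′ ≡ u′
      t′≡u′ = isNegative-injective (proj₂ T-units) (proj₂ T′-units) (cong proj₂ signs≡)
      s≡r : s ≡ r
      s≡r = ℤ.*-cancelʳ-≡ s r (μ₁ - μ₂) {{ℤ.≢-nonZero (μ₁≢μ₂ ∘ ℤ.i-j≡0⇒i≡j μ₁ μ₂)}} (begin
        s * (μ₁ - μ₂)  ≡⟨ sym (ℤ.i-j≡0⇒i≡j _ _ (commutator≡0 T∈C)) ⟩
        c * (t - t′)   ≡⟨ cong₂ (λ x y → c * (x - y)) t≡u t′≡u′ ⟩
        c * (u - u′)   ≡⟨ ℤ.i-j≡0⇒i≡j _ _ (commutator≡0 T′∈C) ⟩
        r * (μ₁ - μ₂)  ∎)

    signs-· : ∀ {T T′} → InCentralizer T → InCentralizer T′ → signs (T · T′) ≡ signs T ⊕ signs T′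
    signs-· {mat t b s t′} {mat u b′ r u′} T∈C T′∈C
      with InCentralizer⇒lower T∈C | InCentralizer⇒lower T′∈C
    ... | refl | refl = cong₂ _,_
      (trans (cong isNegative (diagonal₁ t u r)) (isNegative-* (proj₁ T-units) (proj₁ T′-units)))
      (trans (cong isNegative (diagonal₂ s t′ u′)) (isNegative-* (proj₂ T-units) (proj₂ T′-units)))
      where
      T-units : IsUnit t × IsUnit t′
      T-units = InGL-lower⇒IsUnit {t} {s} {t′} (proj₁ T∈C)
      T′-units : IsUnit u × IsUnit u′
      T′-units = InGL-lower⇒IsUnit {u} {r} {u′} (proj₁ T′∈C)
      diagonal₁ : ∀ t u r → t * u + 0ℤ * r ≡ t * u
      diagonal₁ = solve-∀
      diagonal₂ : ∀ s t′ u′ → s * 0ℤ + t′ * u′ ≡ t′ * u′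
      diagonal₂ = solve-∀

    fromSigns : ℤ → V4 → Mat
    fromSigns s (false , false) = idM
    fromSigns s (true  , true)  = negM idM
    fromSigns s (false , true)  = mat 1ℤ 0ℤ s -1ℤ
    fromSigns s (true  , false) = mat -1ℤ 0ℤ (- s) 1ℤ

    signs-fromSigns : ∀ s b → signs (fromSigns s b) ≡ b
    signs-fromSigns s (false , false) = refl
    signs-fromSigns s (true  , true)  = refl
    signs-fromSigns s (false , true)  = refl
    signs-fromSigns s (true  , false) = refl

    -- A reflection [[1,0],[s,-1]] commutes with L iff s (μ₁ - μ₂) = 2c.
    fromSigns-InCentralizer : ∀ {s} → c * + 2 ≡ s * (μ₁ - μ₂) → ∀ b → InCentralizer (fromSigns s b)
    fromSigns-InCentralizer {s} 2c≡sδ (false , false) = scalar-InCentralizer (inj₁ refl)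
    fromSigns-InCentralizer {s} 2c≡sδ (true  , true)  = scalar-InCentralizer (inj₁ refl)
    fromSigns-InCentralizer {s} 2c≡sδ (false , true)  =
      inj₂ (det-reflection s) , Equivalence.from (commutes⇔ μ₁≢μ₂) (refl , ℤ.i≡j⇒i-j≡0 2c≡sδ)
      where
      det-reflection : ∀ s → 1ℤ * -1ℤ - 0ℤ * s ≡ -1ℤ
      det-reflection = solve-∀
    fromSigns-InCentralizer {s} 2c≡sδ (true  , false) =
      inj₂ (det-reflection s) ,
      Equivalence.from (commutes⇔ μ₁≢μ₂) (refl , trans (negated c s (μ₁ - μ₂)) (cong -_ (ℤ.i≡j⇒i-j≡0 2c≡sδ)))
      where
      det-reflection : ∀ s → -1ℤ * 1ℤ - 0ℤ * - s ≡ -1ℤ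
      det-reflection = solve-∀
      negated : ∀ c s δ → c * (-1ℤ - 1ℤ) - - s * δ ≡ - (c * + 2 - s * δ)
      negated = solve-∀

    InCentralizer-trichotomy : ∀ {T} → InCentralizer T →
                               (T ≡ idM ⊎ T ≡ negM idM) ⊎ (μ₁ - μ₂) Signed.∣ c * + 2
    InCentralizer-trichotomy {mat t b s t′} T∈C with InCentralizer⇒lower T∈C
    ... | refl with InGL-lower⇒IsUnit {t} {s} {t′} (proj₁ T∈C)
    ...   | inj₁ refl , inj₁ refl = inj₁ (inj₁ (signs-injective T∈C (scalar-InCentralizer (inj₁ refl)) refl))
    ...   | inj₂ refl , inj₂ refl = inj₁ (inj₂ (signs-injective T∈C (scalar-InCentralizer (inj₁ refl)) refl))
    ...   | inj₁ refl , inj₂ refl = inj₂ (Signed.divides s (ℤ.i-j≡0⇒i≡j _ _ (commutator≡0 T∈C)))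
    ...   | inj₂ refl , inj₁ refl = inj₂ (Signed.divides (- s) (begin
      c * + 2                              ≡⟨ negated c s (μ₁ - μ₂) ⟩
      - s * (μ₁ - μ₂) - (c * (-1ℤ - 1ℤ) - s * (μ₁ - μ₂)) ≡⟨ cong (λ z → - s * (μ₁ - μ₂) - z) (commutator≡0 T∈C) ⟩
      - s * (μ₁ - μ₂) - 0ℤ                 ≡⟨ ℤ.+-identityʳ (- s * (μ₁ - μ₂)) ⟩
      - s * (μ₁ - μ₂)                      ∎))
      where
      negated : ∀ c s δ → c * + 2 ≡ - s * δ - (c * (-1ℤ - 1ℤ) - s * δ)
      negated = solve-∀

    InCentralizer≅V4 : (μ₁ - μ₂) Signed.∣ c * + 2 → SubgroupIso InCentralizer _·_ AllV4 _⊕_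
    InCentralizer≅V4 (Signed.divides s 2c≡sδ) = record
      { to      = signs
      ; from    = fromSigns s
      ; to-Q    = λ _ → tt
      ; from-P  = λ {b} _ → fromSigns-InCentralizer 2c≡sδ b
      ; from-to = λ {T} T∈C → signs-injective {fromSigns s (signs T)} {T}
                                (fromSigns-InCentralizer 2c≡sδ (signs T)) T∈C (signs-fromSigns s (signs T))
      ; to-from = λ {b} _ → signs-fromSigns s b
      ; hom     = λ {T} {T′} → signs-· {T} {T′}
      }

    InCentralizer⇔±1 : ¬ (μ₁ - μ₂) Signed.∣ c * + 2 → ∀ {T} → InCentralizer T ⇔ (T ≡ idM ⊎ T ≡ negM idM)
    InCentralizer⇔±1 no-reflection = mk⇔
      (λ T∈C → [ id , ⊥-elim ∘ no-reflection ]′ (InCentralizer-trichotomy T∈C))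
      λ { (inj₁ refl) → scalar-InCentralizer (inj₁ refl) ; (inj₂ refl) → scalar-InCentralizer (inj₁ refl) }

    -- A μ-eigenvector m of Lᵀ is a left eigenvector of L, so either μ = μ₂
    -- and m is orthogonal to the right μ₁-eigenvector v₁, or m ∥ e₁.
    transpose-eigen-dichotomy : ∀ {x y μ} → transpose L *ᵛ (x , y) ≡ μ ⋆ (x , y) →
                                y ≡ 0ℤ ⊎ (x , y) ∙ v₁ ≡ 0ℤ
    transpose-eigen-dichotomy {x} {y} {μ} Lᵗm≡μm with y ℤ.≟ 0ℤ
    ... | yes y≡0 = inj₁ y≡0
    ... | no y≢0 = inj₂ (begin
      x * (μ₁ - μ₂) + y * c       ≡⟨ regroup μ₁ c μ₂ x y ⟩
      (μ₁ * x + c * y) - μ₂ * x   ≡⟨ cong (λ z → z - μ₂ * x) (cong proj₁ Lᵗm≡μm) ⟩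
      μ * x - μ₂ * x              ≡⟨ cong (λ z → z * x - μ₂ * x) (sym μ₂≡μ) ⟩
      μ₂ * x - μ₂ * x             ≡⟨ ℤ.+-inverseʳ (μ₂ * x) ⟩
      0ℤ                          ∎)
      where
      regroup : ∀ μ₁ c μ₂ x y → x * (μ₁ - μ₂) + y * c ≡ (μ₁ * x + c * y) - μ₂ * x
      regroup = solve-∀
      second : ∀ μ₂ x y → 0ℤ * x + μ₂ * y ≡ y * μ₂
      second = solve-∀
      μ₂≡μ : μ₂ ≡ μ
      μ₂≡μ = ℤ.*-cancelˡ-≡ y μ₂ μ {{ℤ.≢-nonZero y≢0}}
               (trans (sym (second μ₂ x y)) (trans (cong proj₂ Lᵗm≡μm) (ℤ.*-comm μ y)))

    reflection-from-eigencolumn : ∀ {x y} → (x , y) ∙ v₁ ≡ 0ℤ → y Signed.∣ + 2 →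
                                  (μ₁ - μ₂) Signed.∣ c * + 2
    reflection-from-eigencolumn {x} {y} m⊥v₁ (Signed.divides e 2≡ey) = Signed.divides (- (e * x)) (begin
      c * + 2                                        ≡⟨ cong (c *_) 2≡ey ⟩
      c * (e * y)                                    ≡⟨ regroup μ₁ c μ₂ x y e ⟩
      - (e * x) * (μ₁ - μ₂) + e * (x * (μ₁ - μ₂) + y * c) ≡⟨ cong (λ z → - (e * x) * (μ₁ - μ₂) + e * z) m⊥v₁ ⟩
      - (e * x) * (μ₁ - μ₂) + e * 0ℤ                 ≡⟨ regroup′ (- (e * x) * (μ₁ - μ₂)) e ⟩
      - (e * x) * (μ₁ - μ₂)                          ∎)
      where
      regroup : ∀ μ₁ c μ₂ x y e → c * (e * y) ≡ - (e * x) * (μ₁ - μ₂) + e * (x * (μ₁ - μ₂) + y * c)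
      regroup = solve-∀
      regroup′ : ∀ z e → z + e * 0ℤ ≡ z
      regroup′ = solve-∀

    ⊥v₁⇒dependent : ∀ {x₁ y₁ x₂ y₂} → (x₁ , y₁) ∙ v₁ ≡ 0ℤ → (x₂ , y₂) ∙ v₁ ≡ 0ℤ →
                    x₁ * y₂ - x₂ * y₁ ≡ 0ℤ
    ⊥v₁⇒dependent {x₁} {y₁} {x₂} {y₂} m₁⊥v₁ m₂⊥v₁ =
      [ (λ δ≡0 → ⊥-elim (μ₁≢μ₂ (ℤ.i-j≡0⇒i≡j μ₁ μ₂ δ≡0))) , id ]′ (ℤ.i*j≡0⇒i≡0∨j≡0 (μ₁ - μ₂) δdet≡0)
      where
      expand : ∀ μ₁ c μ₂ x₁ x₂ y₁ y₂ → (μ₁ - μ₂) * (x₁ * y₂ - x₂ * y₁)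
               ≡ (x₁ * (μ₁ - μ₂) + y₁ * c) * y₂ - (x₂ * (μ₁ - μ₂) + y₂ * c) * y₁
      expand = solve-∀
      δdet≡0 : (μ₁ - μ₂) * (x₁ * y₂ - x₂ * y₁) ≡ 0ℤ
      δdet≡0 = begin
        (μ₁ - μ₂) * (x₁ * y₂ - x₂ * y₁)               ≡⟨ expand μ₁ c μ₂ x₁ x₂ y₁ y₂ ⟩
        ((x₁ , y₁) ∙ v₁) * y₂ - ((x₂ , y₂) ∙ v₁) * y₁ ≡⟨ cong₂ (λ a b → a * y₂ - b * y₁) m₁⊥v₁ m₂⊥v₁ ⟩
        0ℤ * y₂ - 0ℤ * y₁                             ≡⟨ cong₂ _-_ (ℤ.*-zeroˡ y₂) (ℤ.*-zeroˡ y₁) ⟩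
        0ℤ                                            ∎

    TransposeDiagonalizable∣2⇒reflection : TransposeDiagonalizable∣2 L → (μ₁ - μ₂) Signed.∣ c * + 2
    TransposeDiagonalizable∣2⇒reflection (M@(mat x₁ x₂ y₁ y₂) , D , D-diagonal , LᵗM≡MD , detM∣2)
      with transpose-eigen-dichotomy {x₁} {y₁} {a₁₁ D}
             (proj₁ (diagonalizing-columns {transpose L} {M} {D} D-diagonal LᵗM≡MD))
         | transpose-eigen-dichotomy {x₂} {y₂} {a₂₂ D}
             (proj₂ (diagonalizing-columns {transpose L} {M} {D} D-diagonal LᵗM≡MD))
    ... | inj₁ refl | inj₁ refl = ⊥-elim (∣2⇒≢0 detM∣2 (zero-row x₁ x₂))
      where
      zero-row : ∀ x₁ x₂ → x₁ * 0ℤ - x₂ * 0ℤ ≡ 0ℤ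
      zero-row = solve-∀
    ... | inj₁ refl | inj₂ m₂⊥v₁ = reflection-from-eigencolumn {x₂} m₂⊥v₁
      (Signed.∣-trans (Signed.divides x₁ (det-entry x₁ x₂ y₂)) (Signed.∣ᵤ⇒∣ detM∣2))
      where
      det-entry : ∀ x₁ x₂ y₂ → x₁ * y₂ - x₂ * 0ℤ ≡ x₁ * y₂
      det-entry = solve-∀
    ... | inj₂ m₁⊥v₁ | inj₁ refl = reflection-from-eigencolumn {x₁} m₁⊥v₁
      (Signed.∣-trans (Signed.divides (- x₂) (det-entry x₁ x₂ y₁)) (Signed.∣ᵤ⇒∣ detM∣2))
      where
      det-entry : ∀ x₁ x₂ y₁ → x₁ * 0ℤ - x₂ * y₁ ≡ - x₂ * y₁
      det-entry = solve-∀
    ... | inj₂ m₁⊥v₁ | inj₂ m₂⊥v₁ = ⊥-elim (∣2⇒≢0 detM∣2 (⊥v₁⇒dependent {x₁} {y₁} {x₂} {y₂} m₁⊥v₁ m₂⊥v₁))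

    -- Lᵀ has the eigenbasis e₁, (s , -2) of index 2.
    reflection⇒TransposeDiagonalizable∣2 : (μ₁ - μ₂) Signed.∣ c * + 2 → TransposeDiagonalizable∣2 L
    reflection⇒TransposeDiagonalizable∣2 (Signed.divides s 2c≡sδ) =
      mat 1ℤ s 0ℤ (- + 2) , mat μ₁ 0ℤ 0ℤ μ₂ , (refl , refl) ,
      mat-≡ (diagonal₁ μ₁ c s) entry₁₂ (zeros μ₁ μ₂) (diagonal₂ μ₂ s) ,
      subst (_∣ + 2) (sym (det-entry s)) ℕ.∣-refl
      where
      diagonal₁ : ∀ μ₁ c s → μ₁ * 1ℤ + c * 0ℤ ≡ 1ℤ * μ₁ + s * 0ℤ
      diagonal₁ = solve-∀
      diagonal₂ : ∀ μ₂ s → 0ℤ * s + μ₂ * - + 2 ≡ 0ℤ * 0ℤ + - + 2 * μ₂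
      diagonal₂ = solve-∀
      zeros : ∀ μ₁ μ₂ → 0ℤ * 1ℤ + μ₂ * 0ℤ ≡ 0ℤ * μ₁ + - + 2 * 0ℤ
      zeros = solve-∀
      det-entry : ∀ s → 1ℤ * - + 2 - s * 0ℤ ≡ - + 2
      det-entry = solve-∀
      regroup : ∀ μ₁ c μ₂ s → μ₁ * s + c * - + 2 ≡ 1ℤ * 0ℤ + s * μ₂ + (s * (μ₁ - μ₂) - c * + 2)
      regroup = solve-∀
      entry₁₂ : μ₁ * s + c * - + 2 ≡ 1ℤ * 0ℤ + s * μ₂
      entry₁₂ = sym (drop-zero-summand (ℤ.i≡j⇒i-j≡0 (sym 2c≡sδ)) (sym (regroup μ₁ c μ₂ s)))

    TransposeDiagonalizable∣2⇔reflection : TransposeDiagonalizable∣2 L ⇔ (μ₁ - μ₂) Signed.∣ c * + 2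
    TransposeDiagonalizable∣2⇔reflection =
      mk⇔ TransposeDiagonalizable∣2⇒reflection reflection⇒TransposeDiagonalizable∣2

  -- geometricSum n = Σ_{i<n} μ₁ⁱ μ₂ⁿ⁻¹⁻ⁱ
  geometricSum : ℕ → ℤ
  geometricSum zero    = 0ℤ
  geometricSum (suc n) = μ₁ ^ n + μ₂ * geometricSum n

  pow-L : ∀ n → pow L n ≡ lower (μ₁ ^ n) (c * geometricSum n) (μ₂ ^ n)
  pow-L zero    = mat-≡ refl refl (sym (ℤ.*-zeroʳ c)) refl
  pow-L (suc n) = trans (cong (L ·_) (pow-L n))
    (mat-≡ (entry₁₁ μ₁ (μ₁ ^ n) (c * geometricSum n)) (entry₁₂ μ₁ (μ₂ ^ n))
           (entry₂₁ c (μ₁ ^ n) μ₂ (geometricSum n)) (entry₂₂ c μ₂ (μ₂ ^ n)))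
    where
    entry₁₁ : ∀ μ a s → μ * a + 0ℤ * s ≡ μ * a
    entry₁₁ = solve-∀
    entry₁₂ : ∀ μ b → μ * 0ℤ + 0ℤ * b ≡ 0ℤ
    entry₁₂ = solve-∀
    entry₂₁ : ∀ c a μ s → c * a + μ * (c * s) ≡ c * (a + μ * s)
    entry₂₁ = solve-∀
    entry₂₂ : ∀ c μ b → c * 0ℤ + μ * b ≡ μ * b
    entry₂₂ = solve-∀

  geometricSum-+ : ∀ m j → geometricSum (m ℕ.+ j) ≡ μ₁ ^ j * geometricSum m + μ₂ ^ m * geometricSum j
  geometricSum-+ zero    j = entry (geometricSum j) (μ₁ ^ j)
    where
    entry : ∀ s a → s ≡ a * 0ℤ + 1ℤ * s
    entry = solve-∀
  geometricSum-+ (suc m) j = begin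
    μ₁ ^ (m ℕ.+ j) + μ₂ * geometricSum (m ℕ.+ j)
      ≡⟨ cong₂ (λ a s → a + μ₂ * s) (ℤ.^-distribˡ-+-* μ₁ m j) (geometricSum-+ m j) ⟩
    μ₁ ^ m * μ₁ ^ j + μ₂ * (μ₁ ^ j * geometricSum m + μ₂ ^ m * geometricSum j)
      ≡⟨ regroup (μ₁ ^ m) (μ₁ ^ j) μ₂ (geometricSum m) (μ₂ ^ m) (geometricSum j) ⟩
    μ₁ ^ j * (μ₁ ^ m + μ₂ * geometricSum m) + μ₂ * μ₂ ^ m * geometricSum j
      ∎
    where
    regroup : ∀ a A μ s b S → a * A + μ * (A * s + b * S) ≡ A * (a + μ * s) + μ * b * S
    regroup = solve-∀

  LowerTriGL⇒InN : (∀ m → Σ ℕ λ j → μ₂ ^ m Signed.∣ μ₁ ^ j) → ∀ {T} → LowerTriGL T → InN L T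
  LowerTriGL⇒InN μ₂ᵐ∣μ₁ʲ {mat t .0ℤ s t′} (T∈GL , refl) = T∈GL , λ m → intertwiner m (μ₂ᵐ∣μ₁ʲ m)
    where
    T : Mat
    T = mat t 0ℤ s t′
    S : ℕ → ℤ
    S = geometricSum
    intertwiner : ∀ m → Σ ℕ (λ j → μ₂ ^ m Signed.∣ μ₁ ^ j) →
                  Σ ℕ λ k → Σ Mat λ B → pow L m · B ≡ T · pow L k
    intertwiner m (j , Signed.divides e μ₁ʲ≡eμ₂ᵐ) = m ℕ.+ j , B , (begin
      pow L m · B
        ≡⟨ cong (_· B) (pow-L m) ⟩
      lower (μ₁ ^ m) (c * S m) (μ₂ ^ m) · B
        ≡⟨ mat-≡ (entry₁₁ (μ₁ ^ m) t (μ₁ ^ j) B₂₁ c (S m) (μ₂ ^ m) (μ₂ ^ j))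
                 (entry₁₂ (μ₁ ^ m) t′ (μ₂ ^ j) t (μ₂ ^ m))
                 (entry₂₁ (μ₁ ^ j) μ₁ʲ≡eμ₂ᵐ)
                 (entry₂₂ c (S m) (μ₂ ^ m) t′ (μ₂ ^ j) s) ⟩
      T · lower (μ₁ ^ m * μ₁ ^ j) (c * (μ₁ ^ j * S m + μ₂ ^ m * S j)) (μ₂ ^ m * μ₂ ^ j)
        ≡⟨ cong (T ·_) (sym (trans (pow-L (m ℕ.+ j))
             (mat-≡ (ℤ.^-distribˡ-+-* μ₁ m j) refl (cong (c *_) (geometricSum-+ m j)) (ℤ.^-distribˡ-+-* μ₂ m j)))) ⟩
      T · pow L (m ℕ.+ j)
        ∎)
      where
      B₂₁ : ℤ
      B₂₁ = e * (s * μ₁ ^ m + (t′ - t) * c * S m) + t′ * c * S j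
      B : Mat
      B = mat (t * μ₁ ^ j) 0ℤ B₂₁ (t′ * μ₂ ^ j)
      entry₁₁ : ∀ a t A x c s b B → a * (t * A) + 0ℤ * x ≡ t * (a * A) + 0ℤ * (c * (A * s + b * B))
      entry₁₁ = solve-∀
      entry₁₂ : ∀ a t′ B t b → a * 0ℤ + 0ℤ * (t′ * B) ≡ t * 0ℤ + 0ℤ * (b * B)
      entry₁₂ = solve-∀
      entry₂₂ : ∀ c s b t′ B σ → c * s * 0ℤ + b * (t′ * B) ≡ σ * 0ℤ + t′ * (b * B)
      entry₂₂ = solve-∀
      entry₂₁ : ∀ A → A ≡ e * μ₂ ^ m →
                c * S m * (t * A) + μ₂ ^ m * (e * (s * μ₁ ^ m + (t′ - t) * c * S m) + t′ * c * S j)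
                ≡ s * (μ₁ ^ m * A) + t′ * (c * (A * S m + μ₂ ^ m * S j))
      entry₂₁ .(e * μ₂ ^ m) refl = identity c (S m) t (μ₂ ^ m) e s (μ₁ ^ m) t′ (S j)
        where
        identity : ∀ c Sm t b e s a t′ Sj →
                   c * Sm * (t * (e * b)) + b * (e * (s * a + (t′ - t) * c * Sm) + t′ * c * Sj)
                   ≡ s * (a * (e * b)) + t′ * (c * (e * b * Sm + b * Sj))
        identity = solve-∀

  InN⇔LowerTriGL : ∀ {p T} → Prime p → (+ p) ∣ μ₁ → ¬ (+ p) ∣ μ₂ →
                   (∀ m → Σ ℕ λ j → μ₂ ^ m Signed.∣ μ₁ ^ j) → InN L T ⇔ LowerTriGL T
  InN⇔LowerTriGL {p} {T} p-prime p∣μ₁ p∤μ₂ μ₂ᵐ∣μ₁ʲ =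
    mk⇔ (λ T∈N → proj₁ T∈N , InN⇒upper≡0 {T = T} p-prime p∣μ₁ p∤μ₂ T∈N) (LowerTriGL⇒InN μ₂ᵐ∣μ₁ʲ {T})

-- Conjugating back to A

module _ {A μ₁ μ₂} (triangularization : Triangularization A μ₁ μ₂) where

  open Triangularization triangularization
  open LowerTriangular μ₁ c μ₂

  InN-A≅InN-L : SubgroupIso (InN A) _·_ (InN L) _·_
  InN-A≅InN-L = subst (λ X → SubgroupIso (InN A) _·_ (InN X) _·_) conj≡lower (conj-SubgroupIso Q∈SL)

  InN-A⇔InN-L : ∀ {T} → InN A T ⇔ InN L (conj Q T)
  InN-A⇔InN-L {T} = subst (λ X → InN A T ⇔ InN X (conj Q T)) conj≡lower (InN-conj-⇔ {Q} {A} {T} Q∈SL)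

  module _ {p q} (p-prime : Prime p) (p∣μ₁ : (+ p) ∣ μ₁) (p∤μ₂ : ¬ (+ p) ∣ μ₂)
                 (q-prime : Prime q) (q∣μ₂ : (+ q) ∣ μ₂) (q∤μ₁ : ¬ (+ q) ∣ μ₁) where

    private
      μ₁≢μ₂ : μ₁ ≢ μ₂
      μ₁≢μ₂ = separating-prime⇒≢ p∣μ₁ p∤μ₂

      diagonalizable⇔reflection : TransposeDiagonalizable∣2 A ⇔ (μ₁ - μ₂) Signed.∣ c * + 2
      diagonalizable⇔reflection =
        ⇔.trans (subst (λ X → TransposeDiagonalizable∣2 A ⇔ TransposeDiagonalizable∣2 X) conj≡lower
                       (TransposeDiagonalizable∣2-conj-⇔ Q∈SL))
                (TransposeDiagonalizable∣2⇔reflection μ₁≢μ₂)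

      InN-L⇔InCentralizer : ∀ {T} → InN L T ⇔ InCentralizer T
      InN-L⇔InCentralizer {T} = InN⇔InCentralizer {p} {q} {T} p-prime p∣μ₁ p∤μ₂ q-prime q∣μ₂ q∤μ₁

    InN≅V4 : TransposeDiagonalizable∣2 A → GroupIso (InN A) _·_ AllV4 _⊕_
    InN≅V4 diagonalizable = SubgroupIso⇒GroupIso (SubgroupIso-trans InN-A≅InN-L
      (SubgroupIso-trans (⇔⇒SubgroupIso InN-L⇔InCentralizer)
        (InCentralizer≅V4 μ₁≢μ₂ (Equivalence.to diagonalizable⇔reflection diagonalizable))))

    InN⇔±1 : ¬ TransposeDiagonalizable∣2 A → (T : Mat) → InN A T ⇔ (T ≡ idM ⊎ T ≡ negM idM)
    InN⇔±1 ¬diagonalizable T =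
      ⇔.trans (InN-A⇔InN-L {T}) (⇔.trans InN-L⇔InCentralizer
        (⇔.trans (InCentralizer⇔±1 μ₁≢μ₂ (¬diagonalizable ∘ Equivalence.from diagonalizable⇔reflection))
                 (conj≡scalar⇔ 1ℤ Q∈SL ⊎-⇔ conj≡scalar⇔ -1ℤ Q∈SL)))

  InN≅LowerTriGL : ∀ {p} → Prime p → (+ p) ∣ μ₁ → ¬ (+ p) ∣ μ₂ →
                   (∀ m → Σ ℕ λ j → μ₂ ^ m Signed.∣ μ₁ ^ j) → GroupIso (InN A) _·_ LowerTriGL _·_
  InN≅LowerTriGL {p} p-prime p∣μ₁ p∤μ₂ μ₂ᵐ∣μ₁ʲ = SubgroupIso⇒GroupIso (SubgroupIso-trans InN-A≅InN-L
    (⇔⇒SubgroupIso λ {T} → InN⇔LowerTriGL {p} {T} p-prime p∣μ₁ p∤μ₂ μ₂ᵐ∣μ₁ʲ))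

eigenvalue≢0 : ∀ {A μ₁ μ₂} → HasEigenvalues A μ₁ μ₂ → det A ≢ 0ℤ → μ₁ ≢ 0ℤ
eigenvalue≢0 {μ₂ = μ₂} (eigenvalues _ Πμ) det≢0 refl = det≢0 (trans (sym Πμ) (ℤ.*-zeroˡ μ₂))

⊆ₚ⇒powers-∣ : ∀ {μ₁ μ₂} → μ₂ ≢ 0ℤ → ∣ μ₂ ∣ ⊆ₚ ∣ μ₁ ∣ → ∀ m → Σ ℕ λ j → μ₂ ^ m Signed.∣ μ₁ ^ j
⊆ₚ⇒powers-∣ {μ₁} {μ₂} μ₂≢0 μ₂⊆μ₁ m =
  let j , μ₂∣μ₁ʲ = ⊆ₚ⇒∣^ {∣ μ₂ ∣} {∣ μ₁ ∣} {{ℤ.≢-nonZero μ₂≢0}} μ₂⊆μ₁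
  in j ℕ.* m , Signed.∣ᵤ⇒∣ {μ₂ ^ m} {μ₁ ^ (j ℕ.* m)}
                 (subst₂ _∣ℕ_ (sym (∣i^n∣ μ₂ m)) (trans (ℕ.^-*-assoc ∣ μ₁ ∣ j m) (sym (∣i^n∣ μ₁ (j ℕ.* m))))
                         (^-mono-∣ μ₂∣μ₁ʲ m))

distinct-radicals : ∀ {A μ₁ μ₂} → HasEigenvalues A μ₁ μ₂ → det A ≢ 0ℤ →
                    ¬ rad μ₁ ∣ℕ rad μ₂ → ¬ rad μ₂ ∣ℕ rad μ₁ →
                    (TransposeDiagonalizable∣2 A → GroupIso (InN A) _·_ AllV4 _⊕_) ×
                    (¬ TransposeDiagonalizable∣2 A → (T : Mat) → InN A T ⇔ (T ≡ idM ⊎ T ≡ negM idM))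
distinct-radicals {A} {μ₁} {μ₂} spec det≢0 ¬r₁∣r₂ ¬r₂∣r₁ =
  let p , p-prime , p∣μ₁ , p∤μ₂ = ¬radℕ∣radℕ⇒prime {∣ μ₁ ∣} {∣ μ₂ ∣} ¬r₁∣r₂
      q , q-prime , q∣μ₂ , q∤μ₁ = ¬radℕ∣radℕ⇒prime {∣ μ₂ ∣} {∣ μ₁ ∣} ¬r₂∣r₁
      triangularization = triangularize spec (separating-prime⇒≢ p∣μ₁ p∤μ₂)
  in InN≅V4 triangularization p-prime p∣μ₁ p∤μ₂ q-prime q∣μ₂ q∤μ₁ ,
     InN⇔±1 triangularization p-prime p∣μ₁ p∤μ₂ q-prime q∣μ₂ q∤μ₁
  where
  instance
    μ₁-nonZero : ℕ.NonZero ∣ μ₁ ∣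
    μ₁-nonZero = ℤ.≢-nonZero (eigenvalue≢0 spec det≢0)
    μ₂-nonZero : ℕ.NonZero ∣ μ₂ ∣
    μ₂-nonZero = ℤ.≢-nonZero (eigenvalue≢0 (HasEigenvalues-swap spec) det≢0)

nested-radicals : ∀ {A μ₁ μ₂ p} → HasEigenvalues A μ₁ μ₂ → det A ≢ 0ℤ → InP′ A p →
                  rad μ₂ ∣ℕ rad μ₁ → GroupIso (InN A) _·_ LowerTriGL _·_
nested-radicals {A} {μ₁} {μ₂} {p} spec det≢0 p∈𝒫′ r₂∣r₁ =
  InN≅LowerTriGL (triangularize spec (separating-prime⇒≢ p∣μ₁ p∤μ₂)) p-prime p∣μ₁ p∤μ₂
                 (⊆ₚ⇒powers-∣ μ₂≢0 μ₂⊆μ₁)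
  where
  μ₂≢0 : μ₂ ≢ 0ℤ
  μ₂≢0 = eigenvalue≢0 (HasEigenvalues-swap spec) det≢0
  μ₂⊆μ₁ : ∣ μ₂ ∣ ⊆ₚ ∣ μ₁ ∣
  μ₂⊆μ₁ = radℕ∣radℕ⇒⊆ₚ {∣ μ₁ ∣} {∣ μ₂ ∣} {{ℤ.≢-nonZero μ₂≢0}} r₂∣r₁
  p-prime : Prime p
  p-prime = proj₁ (proj₁ p∈𝒫′)
  -- p divides exactly one eigenvalue; it cannot be μ₂, whose primes all divide μ₁.
  p-separates : ((+ p) ∣ μ₁) × ¬ ((+ p) ∣ μ₂)
  p-separates = [ id , (λ (p∣μ₂ , p∤μ₁) → ⊥-elim (p∤μ₁ (μ₂⊆μ₁ p-prime p∣μ₂))) ]′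
                  (𝒫′⇒divides-exactly-one spec p∈𝒫′)
  p∣μ₁ : (+ p) ∣ μ₁
  p∣μ₁ = proj₁ p-separates
  p∤μ₂ : ¬ (+ p) ∣ μ₂
  p∤μ₂ = proj₂ p-separates

proposition7p5 : (A : Mat) → det A ≢ 0ℤ →
  Σ ℕ (InP A) → Σ ℕ (InP′ A) → Reducible (charPoly A) →
  Σ ℤ λ λ₁ → Σ ℤ λ λ₂ →
    (λ₁ ≢ λ₂) × IsEigenvalue A λ₁ × IsEigenvalue A λ₂ ×
    ((¬ (rad λ₁ ∣ℕ rad λ₂) × ¬ (rad λ₂ ∣ℕ rad λ₁)) →
      ((Σ Mat λ M → Σ Mat λ D →
          IsDiagonal D × (transpose A · M ≡ M · D) × (det M ∣ + 2)) →
        GroupIso (InN A) _·_ AllV4 _⊕_)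
      × (¬ (Σ Mat λ M → Σ Mat λ D →
          IsDiagonal D × (transpose A · M ≡ M · D) × (det M ∣ + 2)) →
        (T : Mat) → InN A T ⇔ ((T ≡ idM) ⊎ (T ≡ negM idM))))
    × (((rad λ₁ ∣ℕ rad λ₂) ⊎ (rad λ₂ ∣ℕ rad λ₁)) →
      GroupIso (InN A) _·_ LowerTriGL _·_)
-- 𝒫(A) ≠ ∅ is implied by 𝒫′(A) ≠ ∅.
proposition7p5 A det≢0 _ (p , p∈𝒫′) reducible =
  let μ₁ , μ₂ , spec = reducible⇒eigenvalues reducible
  in μ₁ , μ₂ , 𝒫′⇒distinct spec p∈𝒫′ ,
     HasEigenvalues⇒IsEigenvalue spec , HasEigenvalues⇒IsEigenvalue (HasEigenvalues-swap spec) ,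
     (λ (¬r₁∣r₂ , ¬r₂∣r₁) → distinct-radicals spec det≢0 ¬r₁∣r₂ ¬r₂∣r₁) ,
     [ nested-radicals (HasEigenvalues-swap spec) det≢0 p∈𝒫′ , nested-radicals spec det≢0 p∈𝒫′ ]′
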